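{- Let $G$ be an $R$-disjoint graph, $C$ an odd cycle of $G$, and $x\in R(C)$. Let $M$ be a maximum matching of $G$ and $F$ an $M$-flower of $G$ with $M$-blossom $C$ and base $c\in V(C)$ such that $x\in V(F)$. Then: (i) if $x\in V(C)$, then $x\in D(G)$; (ii) if $x\notin V(C)$ and $d_F(x,c)$ is even, then $x\in D(G)$; (iii) if $x\notin V(C)$ and $d_F(x,c)$ is odd, then $x\in A(G)$.
   Context: All graphs are finite, simple and undirected. $d_F(x,c)$ is the length of a shortest $x$–$c$ path in $F$. Let $M$ be a matching of $G$. An $M$-blossom is an odd cycle of length $2k+1$ containing exactly $k$ edges of $M$; its base is the vertex of the cycle not covered by these $k$ edges. An $M$-stem is an $M$-alternating path of even length (possibly zero) joining the base of the blossom to a vertex not saturated by $M$, and sharing only the base with the blossom. An $M$-flower is an $M$-blossom together with an $M$-stem. For an odd cycle $C$ of $G$, the reach set $R(C)$ is the union of $V(F)$ over all $M$-flowers $F$ of $G$ whose $M$-blossom is $C$, where $M$ ranges over all maximum matchings of $G$. A graph $G$ is $R$-disjoint if it has at least one odd cycle, $R(C)\neq\emptyset$ for every odd cycle $C$, and $R(C)\cap R(C')=\emptyset$ for every two distinct odd cycles $C,C'$ of $G$. Gallai–Edmonds sets: $D(G)$ is the set of vertices missed by some maximum matching of $G$; $A(G)$ is the set of vertices not in $D(G)$ having a neighbor in $D(G)$; $C(G)=V(G)\setminus(D(G)\cup A(G))$. -}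

module Defs where

open import Data.Nat using (ℕ; zero; suc; _+_; _*_; _≤_)
open import Data.Fin using (Fin)
open import Data.Fin.Properties using () renaming (_≟_ to _≟F_)
open import Data.List using (List; []; _∷_; _++_; [_]; length; filter; concatMap; last)
open import Data.List.Membership.Propositional using (_∈_; _∉_)
open import Data.List.Membership.DecPropositional using () renaming (_∈?_ to ∈?-gen)
open import Data.List.Relation.Unary.All using (All)
open import Data.List.Relation.Unary.Unique.Propositional using (Unique)
open import Data.Maybe using (Maybe; just; nothing)
open import Data.Product using (Σ; ∃; _×_; _,_; proj₁; proj₂)
open import Data.Product.Properties using (≡-dec)
open import Data.Sum using (_⊎_)
open import Data.Unit using (⊤)
open import Data.Empty using (⊥)
open import Relation.Nullary using (¬_; Dec)
open import Relation.Nullary.Decidable using (_⊎-dec_)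
open import Relation.Binary.PropositionalEquality using (_≡_; _≢_)

record Graph (n : ℕ) : Set₁ where
  field
    Adj    : Fin n → Fin n → Set
    sym    : ∀ {u v} → Adj u v → Adj v u
    irrefl : ∀ {u} → ¬ Adj u u
open Graph public

Even Odd : ℕ → Set
Even d = ∃ λ k → d ≡ k + k
Odd  d = ∃ λ k → d ≡ suc (k + k)

module _ {n : ℕ} where

  V : Set
  V = Fin n

  pairs : List V → List (V × V)
  pairs (x ∷ y ∷ xs) = (x , y) ∷ pairs (y ∷ xs)
  pairs _            = []

  _∈E_ : V × V → List (V × V) → Set
  (u , v) ∈E es = ((u , v) ∈ es) ⊎ ((v , u) ∈ es)

  _∈E?_ : (e : V × V) → (es : List (V × V)) → Dec (e ∈E es)
  (u , v) ∈E? es = ∈?-gen (≡-dec _≟F_ _≟F_) (u , v) es ⊎-dec ∈?-gen (≡-dec _≟F_ _≟F_) (v , u) es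

  endpoints : List (V × V) → List V
  endpoints = concatMap (λ e → proj₁ e ∷ proj₂ e ∷ [])

  IsMatching : Graph n → List (V × V) → Set
  IsMatching G M = All (λ e → Adj G (proj₁ e) (proj₂ e)) M × Unique (endpoints M)

  IsMaxMatching : Graph n → List (V × V) → Set
  IsMaxMatching G M =
    IsMatching G M × (∀ M' → IsMatching G M' → length M' ≤ length M)

  Saturated : List (V × V) → V → Set
  Saturated M v = v ∈ endpoints M

  Dset : Graph n → V → Set
  Dset G v = ∃ λ M → IsMaxMatching G M × ¬ Saturated M v

  Aset : Graph n → V → Set
  Aset G v = ¬ Dset G v × ∃ λ u → Adj G v u × Dset G u

  -- Cycles, given by a cyclic sequence of distinct vertices v0 … v_{l-1}

  cycEdges : List V → List (V × V)
  cycEdges []       = []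
  cycEdges (v ∷ vs) = pairs ((v ∷ vs) ++ [ v ])

  record OddCycle (G : Graph n) (C : List V) : Set where
    field
      distinct : Unique C
      long     : 3 ≤ length C
      oddLen   : Odd (length C)
      adjacent : All (λ e → Adj G (proj₁ e) (proj₂ e)) (cycEdges C)

  -- two cycle sequences describe the same cycle (same subgraph = same edge set)
  SameCycle : List V → List V → Set
  SameCycle C C' = ∀ e → (e ∈E cycEdges C → e ∈E cycEdges C') × (e ∈E cycEdges C' → e ∈E cycEdges C)

  cycMEdges : List (V × V) → List V → ℕ
  cycMEdges M C = length (filter (λ e → e ∈E? M) (cycEdges C))

  IsBlossom : List (V × V) → List V → Set
  IsBlossom M C = suc (2 * cycMEdges M C) ≡ length C

  IsBase : List (V × V) → List V → V → Set
  IsBase M C c = c ∈ C ×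
    (∀ u v → (u , v) ∈ cycEdges C → (u , v) ∈E M → c ≢ u × c ≢ v)

  Alternating : List (V × V) → List (V × V) → Set
  Alternating M (e ∷ f ∷ es) =
    (e ∈E M → ¬ (f ∈E M)) × (¬ (e ∈E M) → f ∈E M) × Alternating M (f ∷ es)
  Alternating M _ = ⊤

  record IsStem (G : Graph n) (M : List (V × V)) (C : List V) (c : V) (rest : List V) : Set where
    field
      distinct    : Unique (c ∷ rest)
      adjacent    : All (λ e → Adj G (proj₁ e) (proj₂ e)) (pairs (c ∷ rest))
      evenLen     : Even (length rest)
      alternating : Alternating M (pairs (c ∷ rest))
      endFree     : ∀ w → last (c ∷ rest) ≡ just w → ¬ Saturated M w
      onlyBase    : All (λ w → w ∉ C) rest

  record Flower (G : Graph n) (M : List (V × V)) (C : List V) : Set where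
    field
      blossom : IsBlossom M C
      base    : V
      isBase  : IsBase M C base
      stem    : List V
      isStem  : IsStem G M C base stem
  open Flower public

  _∈VF_ : ∀ {G M C} → V → Flower G M C → Set
  _∈VF_ {C = C} x F = x ∈ C ⊎ x ∈ (base F ∷ stem F)

  EdgeF : ∀ {G M C} → Flower G M C → V → V → Set
  EdgeF {C = C} F u v = ((u , v) ∈E cycEdges C) ⊎ ((u , v) ∈E pairs (base F ∷ stem F))

  data WalkF {G M C} (F : Flower G M C) : V → V → ℕ → Set where
    here : ∀ {x} → WalkF F x x 0
    step : ∀ {x y z d} → EdgeF F x y → WalkF F y z d → WalkF F x z (suc d)

  DistF : ∀ {G M C} → Flower G M C → V → V → ℕ → Set
  DistF F x y d = WalkF F x y d × (∀ d' → WalkF F x y d' → d ≤ d')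

  Reach : Graph n → List V → V → Set
  Reach G C x = ∃ λ M → IsMaxMatching G M × Σ (Flower G M C) (λ F → x ∈VF F)

  RDisjoint : Graph n → Set
  RDisjoint G =
    (∃ λ C → OddCycle G C) ×
    (∀ C → OddCycle G C → ∃ λ x → Reach G C x) ×
    (∀ C C' → OddCycle G C → OddCycle G C' → ¬ SameCycle C C' →
       ∀ x → Reach G C x → Reach G C' x → ⊥)

module Submission where

-- Write the stem of F as c = s₀, s₁, …, s₂ₘ = w, with w exposed and s₂ᵢs₂ᵢ₊₁ ∈ M; a stem vertex x = s_d has
-- d = d_F(x, c). A vertex of C or an s₂ᵢ starts an even alternating path through the rest of the flower ending
-- at w; rematching along it gives a maximum matching missing that vertex. For odd d, x is adjacent to s_{d-1} ∈ D.
-- If a maximum matching M′ missed x, the component of x in M Δ M′ would give an even M-alternating path Q from an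
-- M-exposed vertex to x, ending with the M-edge s_{d-1}x. R-disjointness forbids odd cycles through s₁, …, s₂ₘ,
-- as such a vertex lies in R(C) and in the reach set of the cycle. So each excursion of Q away from the stem
-- returns at a stem index of the parity Q predicts, and following Q from its exposed end yields either an
-- M-augmenting path or a parity contradiction at x.

open import Defs renaming (sym to Adj-sym)
open import Data.Bool using (Bool; true; false; not; _xor_)
open import Data.Bool.Properties
  using (not-involutive; not-distribˡ-xor; xor-identityʳ; xor-inverseˡ; xor-assoc; xor-same; xor-comm; ¬-not)
  renaming (_≟_ to _≟ᵇ_)
open import Data.Empty using (⊥; ⊥-elim)
open import Data.Fin using (Fin)
open import Data.Fin.Properties using (_≟_)
open import Data.List using (List; []; _∷_; _++_; [_]; length; reverse; filter; last; _∷ʳ′_; initLast)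
open import Data.List.Membership.Propositional using (_∈_; _∉_)
open import Data.List.Membership.Propositional.Properties using (∈-++⁺ˡ; ∈-++⁺ʳ; ∈-++⁻; ∈-∃++; ∈-filter⁻; ∈-allFin)
open import Data.List.Properties
  using (length-++; ++-assoc; ∷-injective; unfold-reverse; length-reverse; reverse-++; filter-accept; filter-reject;
         filter-++; length-tabulate)
open import Data.List.Relation.Binary.Disjoint.Propositional using (Disjoint)
open import Data.List.Relation.Unary.All as All using (All; []; _∷_)
import Data.List.Relation.Unary.All.Properties as AllP
open import Data.List.Relation.Unary.AllPairs as AllPairs using ([]; _∷_)
open import Data.List.Relation.Unary.Any using (here; there)
open import Data.List.Relation.Unary.Any.Properties using (reverse⁻)
open import Data.List.Relation.Unary.Unique.Propositional using (Unique)
open import Data.List.Relation.Unary.Unique.Propositional.Properties using (++⁺; Unique[x∷xs]⇒x∉xs)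
open import Data.Maybe using (just)
open import Data.Nat using (ℕ; zero; suc; _+_; _≤_; _<_; z≤n; s≤s)
open import Data.Nat.Properties
  using (+-suc; +-comm; +-assoc; +-identityʳ; ≤-trans; ≤-refl; ≤-reflexive; ≤-antisym; ≤-pred; m≤n⇒m≤1+n;
         m+n≤o⇒m≤o; m≤n+m; +-monoʳ-≤; +-mono-≤; <⇒≱; ≰⇒>; _≤?_; <-irrefl; suc-injective; 0≢1+n; module ≤-Reasoning)
open import Data.Product using (∃; ∃₂; _×_; _,_; proj₁; proj₂; swap)
open import Data.Sum as Sum using (_⊎_; inj₁; inj₂; [_,_]′)
open import Data.Unit using (⊤; tt)
open import Function using (_∘_; id)
open import Relation.Binary.PropositionalEquality
  using (_≡_; _≢_; refl; sym; trans; cong; cong₂; subst; subst₂; module ≡-Reasoning)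
open import Relation.Nullary using (¬_; Dec; yes; no; does; ¬?; contradiction)
open import Relation.Unary using (Decidable)

isOdd : ℕ → Bool
isOdd zero    = false
isOdd (suc n) = not (isOdd n)

isOdd-+ : ∀ m n → isOdd (m + n) ≡ isOdd m xor isOdd n
isOdd-+ zero    n = refl
isOdd-+ (suc m) n = trans (cong not (isOdd-+ m n)) (not-distribˡ-xor (isOdd m) (isOdd n))

isOdd-double : ∀ k → isOdd (k + k) ≡ false
isOdd-double k with isOdd k | isOdd-+ k k
... | false | eq = eq
... | true  | eq = eq

isOdd-even : ∀ {d} → Even d → isOdd d ≡ false
isOdd-even (k , refl) = isOdd-double k

isOdd-odd : ∀ {d} → Odd d → isOdd d ≡ true
isOdd-odd (k , refl) = cong not (isOdd-double k)

isOdd-suc-suc : ∀ k {b} → isOdd (suc (suc k)) ≡ b → isOdd k ≡ b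
isOdd-suc-suc k = trans (sym (not-involutive (isOdd k)))

isOdd-∷ʳ : ∀ {A : Set} (xs : List A) y → isOdd (length (xs ++ [ y ])) ≡ not (isOdd (length xs))
isOdd-∷ʳ xs y = trans (cong isOdd (length-++ xs)) (cong isOdd (+-comm (length xs) 1))

isOdd-++-∷ : ∀ {A : Set} (xs : List A) {y} ys → isOdd (length (xs ++ y ∷ ys)) ≡ isOdd (length xs) xor not (isOdd (length ys))
isOdd-++-∷ xs ys = trans (cong isOdd (length-++ xs)) (isOdd-+ (length xs) (suc (length ys)))

xor-cancelˡ : ∀ a b → a xor (a xor b) ≡ b
xor-cancelˡ a b = trans (sym (xor-assoc a a b)) (cong (_xor b) (xor-same a))

isOdd⇒Odd : ∀ d → isOdd d ≡ true → Odd d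
isOdd⇒Odd zero ()
isOdd⇒Odd (suc zero) _ = 0 , refl
isOdd⇒Odd (suc (suc d)) e with isOdd⇒Odd d (isOdd-suc-suc d e)
... | k , refl = suc k , cong (λ m → suc (suc m)) (sym (+-suc k k))

half-≤ : ∀ a b → a + a ≤ suc (b + b) → a ≤ b
half-≤ a b h with a ≤? b
... | yes a≤b = a≤b
... | no  a≰b = contradiction h (<⇒≱ (subst (_≤ a + a) (cong suc (+-suc b b)) (+-mono-≤ b<a b<a)))
  where b<a = ≰⇒> a≰b

module _ {A : Set} where

  Unique-∷ : ∀ {x : A} {xs} → x ∉ xs → Unique xs → Unique (x ∷ xs)
  Unique-∷ {xs = xs} x∉xs u = AllP.¬Any⇒All¬ xs x∉xs ∷ u

  Unique-++⁻ˡ : ∀ xs {ys : List A} → Unique (xs ++ ys) → Unique xs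
  Unique-++⁻ˡ []       _ = []
  Unique-++⁻ˡ (x ∷ xs) u =
    Unique-∷ (λ m → Unique[x∷xs]⇒x∉xs u (∈-++⁺ˡ m)) (Unique-++⁻ˡ xs (AllPairs.tail u))

  Unique-++⁻ʳ : ∀ xs {ys : List A} → Unique (xs ++ ys) → Unique ys
  Unique-++⁻ʳ []       u = u
  Unique-++⁻ʳ (x ∷ xs) u = Unique-++⁻ʳ xs (AllPairs.tail u)

  Unique-++⇒Disjoint : ∀ xs {ys : List A} → Unique (xs ++ ys) → Disjoint xs ys
  Unique-++⇒Disjoint (x ∷ xs) u (here refl , y∈ys) = Unique[x∷xs]⇒x∉xs u (∈-++⁺ʳ xs y∈ys)
  Unique-++⇒Disjoint (x ∷ xs) u (there m , y∈ys)   = Unique-++⇒Disjoint xs (AllPairs.tail u) (m , y∈ys)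

  Unique-reverse : ∀ {xs : List A} → Unique xs → Unique (reverse xs)
  Unique-reverse {[]}     _ = []
  Unique-reverse {x ∷ xs} u rewrite unfold-reverse x xs =
    ++⁺ (Unique-reverse (AllPairs.tail u)) ([] ∷ [])
        (λ { (m , here refl) → Unique[x∷xs]⇒x∉xs u (reverse⁻ m) })

  reverse-ends : ∀ (x : A) xs y → reverse (x ∷ xs ++ [ y ]) ≡ y ∷ reverse xs ++ [ x ]
  reverse-ends x xs y = trans (unfold-reverse x (xs ++ [ y ])) (cong (_++ [ x ]) (reverse-++ xs [ y ]))

  Unique-reverse-ends : ∀ {x : A} {xs y} → Unique (x ∷ xs ++ [ y ]) → Unique (y ∷ reverse xs ++ [ x ])
  Unique-reverse-ends {x} {xs} {y} u = subst Unique (reverse-ends x xs y) (Unique-reverse u)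

  Unique⇒length≤ : ∀ {xs ys : List A} → Unique xs → (∀ {z} → z ∈ xs → z ∈ ys) → length xs ≤ length ys
  Unique⇒length≤ {[]}     _ _ = z≤n
  Unique⇒length≤ {x ∷ xs} u xs⊆ys with ∈-∃++ (xs⊆ys (here refl))
  ... | ys₁ , ys₂ , refl = begin
    suc (length xs)               ≤⟨ s≤s (Unique⇒length≤ (AllPairs.tail u) xs⊆ys₁ys₂) ⟩
    suc (length (ys₁ ++ ys₂))     ≡⟨ cong suc (length-++ ys₁) ⟩
    suc (length ys₁ + length ys₂) ≡⟨ sym (+-suc (length ys₁) (length ys₂)) ⟩
    length ys₁ + suc (length ys₂) ≡⟨ sym (length-++ ys₁) ⟩
    length (ys₁ ++ x ∷ ys₂)       ∎
    where
    open ≤-Reasoning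
    xs⊆ys₁ys₂ : ∀ {z} → z ∈ xs → z ∈ ys₁ ++ ys₂
    xs⊆ys₁ys₂ m with ∈-++⁻ ys₁ (xs⊆ys (there m))
    ... | inj₁ m₁         = ∈-++⁺ˡ m₁
    ... | inj₂ (here refl) = ⊥-elim (Unique[x∷xs]⇒x∉xs u m)
    ... | inj₂ (there m₂)  = ∈-++⁺ʳ ys₁ m₂

  Unique⇒position-unique : ∀ {A₁ A₂ B₁ B₂ : List A} {u} → Unique (A₁ ++ u ∷ B₁) →
                 A₁ ++ u ∷ B₁ ≡ A₂ ++ u ∷ B₂ → A₁ ≡ A₂ × B₁ ≡ B₂
  Unique⇒position-unique {[]}     {[]}     _ refl = refl , refl
  Unique⇒position-unique {[]}     {x ∷ A₂} u eq with ∷-injective eq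
  ... | refl , eq′ = ⊥-elim (Unique[x∷xs]⇒x∉xs u (subst (_ ∈_) (sym eq′) (∈-++⁺ʳ A₂ (here refl))))
  Unique⇒position-unique {x ∷ A₁} {[]}     u refl = ⊥-elim (Unique[x∷xs]⇒x∉xs u (∈-++⁺ʳ A₁ (here refl)))
  Unique⇒position-unique {x ∷ A₁} {y ∷ A₂} u eq with ∷-injective eq
  ... | refl , eq′ with Unique⇒position-unique {A₁} {A₂} (AllPairs.tail u) eq′
  ...   | refl , refl = refl , refl

  positions-ordered : ∀ (A₁ A₂ B₁ B₂ : List A) {p q} → p ≢ q → A₁ ++ p ∷ B₁ ≡ A₂ ++ q ∷ B₂ →
     (∃ λ Mid → A₂ ≡ A₁ ++ p ∷ Mid × B₁ ≡ Mid ++ q ∷ B₂) ⊎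
     (∃ λ Mid → A₁ ≡ A₂ ++ q ∷ Mid × B₂ ≡ Mid ++ p ∷ B₁)
  positions-ordered []       []       B₁ B₂ p≢q refl = ⊥-elim (p≢q refl)
  positions-ordered []       (x ∷ A₂) B₁ B₂ p≢q refl = inj₁ (A₂ , refl , refl)
  positions-ordered (x ∷ A₁) []       B₁ B₂ p≢q refl = inj₂ (A₁ , refl , refl)
  positions-ordered (x ∷ A₁) (y ∷ A₂) B₁ B₂ p≢q eq with ∷-injective eq
  ... | refl , eq′ with positions-ordered A₁ A₂ B₁ B₂ p≢q eq′
  ...   | inj₁ (Mid , refl , e) = inj₁ (Mid , refl , e)
  ...   | inj₂ (Mid , refl , e) = inj₂ (Mid , refl , e)

  module _ {P : A → Set} (P? : Decidable P) where

    splitAtFirst : ∀ xs → All (¬_ ∘ P) xs ⊎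
      (∃₂ λ ys zs → ∃ λ z → xs ≡ ys ++ z ∷ zs × P z × All (¬_ ∘ P) ys)
    splitAtFirst []       = inj₁ []
    splitAtFirst (x ∷ xs) with P? x | splitAtFirst xs
    ... | yes px  | _       = inj₂ ([] , xs , x , refl , px , [])
    ... | no ¬px  | inj₁ ¬P = inj₁ (¬px ∷ ¬P)
    ... | no ¬px  | inj₂ (ys , zs , z , refl , pz , ¬P) = inj₂ (x ∷ ys , zs , z , refl , pz , ¬px ∷ ¬P)


module _ {n : ℕ} where

  pairs-++-∷ : ∀ (xs : List (Fin n)) y ys → pairs (xs ++ y ∷ ys) ≡ pairs (xs ++ [ y ]) ++ pairs (y ∷ ys)
  pairs-++-∷ []           y ys = refl
  pairs-++-∷ (x ∷ [])     y ys = refl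
  pairs-++-∷ (x ∷ x′ ∷ xs) y ys = cong ((x , x′) ∷_) (pairs-++-∷ (x′ ∷ xs) y ys)

  ∈-pairs⇒∈ : ∀ {u v : Fin n} xs → (u , v) ∈ pairs xs → u ∈ xs × v ∈ xs
  ∈-pairs⇒∈ (x ∷ y ∷ xs) (here refl) = here refl , there (here refl)
  ∈-pairs⇒∈ (x ∷ y ∷ xs) (there m) with ∈-pairs⇒∈ (y ∷ xs) m
  ... | u∈ , v∈ = there u∈ , there v∈

  ∈-pairs⇒split : ∀ {u v : Fin n} xs → (u , v) ∈ pairs xs → ∃₂ λ A B → xs ≡ A ++ u ∷ v ∷ B
  ∈-pairs⇒split (x ∷ y ∷ xs) (here refl) = [] , xs , refl
  ∈-pairs⇒split (x ∷ y ∷ xs) (there m) with ∈-pairs⇒split (y ∷ xs) m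
  ... | A , B , eq = x ∷ A , B , cong (x ∷_) eq

  ∈⇒∈-pairs-∷ʳ : ∀ {z : Fin n} xs y → z ∈ xs → ∃ λ v → (z , v) ∈ pairs (xs ++ [ y ])
  ∈⇒∈-pairs-∷ʳ (x ∷ [])      y (here refl) = y , here refl
  ∈⇒∈-pairs-∷ʳ (x ∷ x′ ∷ xs) y (here refl) = x′ , here refl
  ∈⇒∈-pairs-∷ʳ (x ∷ x′ ∷ xs) y (there m) with ∈⇒∈-pairs-∷ʳ (x′ ∷ xs) y m
  ... | v , m′ = v , there m′

  pairs-successor : ∀ {S A B : List (Fin n)} {u v} → Unique S → S ≡ A ++ u ∷ B →
                    (u , v) ∈ pairs S → ∃ λ B′ → B ≡ v ∷ B′
  pairs-successor {S} {A} uS refl m with ∈-pairs⇒split S m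
  ... | A′ , B′ , eq with Unique⇒position-unique {A₁ = A} {A₂ = A′} uS eq
  ...   | refl , refl = B′ , refl

  pairs-predecessor : ∀ {S A B : List (Fin n)} {u v} → Unique S → S ≡ A ++ u ∷ B →
                      (v , u) ∈ pairs S → ∃ λ A′ → A ≡ A′ ++ [ v ]
  pairs-predecessor {S} {A} {B} {u} {v} uS refl m with ∈-pairs⇒split S m
  ... | A′ , B′ , eq with Unique⇒position-unique {A₁ = A} {A₂ = A′ ++ [ v ]} uS (trans eq (sym (++-assoc A′ [ v ] (u ∷ B′))))
  ...   | refl , refl = A′ , refl

  endpoints-++ : ∀ (xs ys : List (Fin n × Fin n)) → endpoints (xs ++ ys) ≡ endpoints xs ++ endpoints ys
  endpoints-++ []       ys = refl
  endpoints-++ (e ∷ xs) ys = cong (λ l → proj₁ e ∷ proj₂ e ∷ l) (endpoints-++ xs ys)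

  length-endpoints : ∀ (xs : List (Fin n × Fin n)) → length (endpoints xs) ≡ length xs + length xs
  length-endpoints []       = refl
  length-endpoints (e ∷ xs) = cong suc (trans (cong suc (length-endpoints xs)) (sym (+-suc _ _)))

  pairUp : List (Fin n) → List (Fin n × Fin n)
  pairUp (x ∷ y ∷ xs) = (x , y) ∷ pairUp xs
  pairUp _            = []

  endpoints-pairUp : ∀ xs → isOdd (length xs) ≡ false → endpoints (pairUp xs) ≡ xs
  endpoints-pairUp []           _ = refl
  endpoints-pairUp (x ∷ y ∷ xs) e =
    cong (λ l → x ∷ y ∷ l) (endpoints-pairUp xs (isOdd-suc-suc (length xs) e))

  length-pairUp : ∀ xs → isOdd (length xs) ≡ false → length (pairUp xs) + length (pairUp xs) ≡ length xs
  length-pairUp xs e = trans (sym (length-endpoints (pairUp xs))) (cong length (endpoints-pairUp xs e))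

  pairUp-++ : ∀ xs ys → isOdd (length xs) ≡ false → pairUp (xs ++ ys) ≡ pairUp xs ++ pairUp ys
  pairUp-++ []           ys _ = refl
  pairUp-++ (x ∷ y ∷ xs) ys e = cong ((x , y) ∷_) (pairUp-++ xs ys (isOdd-suc-suc (length xs) e))

  Unique⇒length≤n : ∀ {xs : List (Fin n)} → Unique xs → length xs ≤ n
  Unique⇒length≤n {xs} u = subst (length xs ≤_) (length-tabulate id) (Unique⇒length≤ u (λ {z} _ → ∈-allFin z))

module _ {n : ℕ} (G : Graph n) where

  open import Data.List.Membership.DecPropositional (_≟_ {n}) using (_∈?_)

  AdjE : Fin n × Fin n → Set
  AdjE (u , v) = Adj G u v

  IsWalk : List (Fin n) → Set
  IsWalk (x ∷ y ∷ xs) = Adj G x y × IsWalk (y ∷ xs)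
  IsWalk _            = ⊤

  IsWalk⇒All-AdjE : ∀ xs → IsWalk xs → All AdjE (pairs xs)
  IsWalk⇒All-AdjE []           _       = []
  IsWalk⇒All-AdjE (x ∷ [])     _       = []
  IsWalk⇒All-AdjE (x ∷ y ∷ xs) (a , w) = a ∷ IsWalk⇒All-AdjE (y ∷ xs) w

  All-AdjE⇒IsWalk : ∀ xs → All AdjE (pairs xs) → IsWalk xs
  All-AdjE⇒IsWalk []           _       = tt
  All-AdjE⇒IsWalk (x ∷ [])     _       = tt
  All-AdjE⇒IsWalk (x ∷ y ∷ xs) (a ∷ w) = a , All-AdjE⇒IsWalk (y ∷ xs) w

  IsWalk-join : ∀ xs {y} ys → IsWalk (xs ++ [ y ]) → IsWalk (y ∷ ys) → IsWalk (xs ++ y ∷ ys)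
  IsWalk-join []            ys _        w = w
  IsWalk-join (x ∷ [])      ys (a , _)  w = a , w
  IsWalk-join (x ∷ x′ ∷ xs) ys (a , w₁) w = a , IsWalk-join (x′ ∷ xs) ys w₁ w

  IsWalk-tail : ∀ {x} xs → IsWalk (x ∷ xs) → IsWalk xs
  IsWalk-tail []       _       = tt
  IsWalk-tail (y ∷ xs) (_ , w) = w

  IsWalk-++⁻ˡ : ∀ xs ys → IsWalk (xs ++ ys) → IsWalk xs
  IsWalk-++⁻ˡ []            ys _       = tt
  IsWalk-++⁻ˡ (x ∷ [])      ys _       = tt
  IsWalk-++⁻ˡ (x ∷ x′ ∷ xs) ys (a , w) = a , IsWalk-++⁻ˡ (x′ ∷ xs) ys w

  IsWalk-++⁻ʳ : ∀ xs ys → IsWalk (xs ++ ys) → IsWalk ys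
  IsWalk-++⁻ʳ []       ys w = w
  IsWalk-++⁻ʳ (x ∷ xs) ys w = IsWalk-++⁻ʳ xs ys (IsWalk-tail (xs ++ ys) w)

  IsWalk-reverse : ∀ xs → IsWalk xs → IsWalk (reverse xs)
  IsWalk-reverse []           _ = tt
  IsWalk-reverse (x ∷ [])     _ = tt
  IsWalk-reverse (x ∷ y ∷ xs) (a , w) =
    subst IsWalk (sym (trans eq (++-assoc (reverse xs) [ y ] [ x ])))
      (IsWalk-join (reverse xs) [ x ] (subst IsWalk (unfold-reverse y xs) (IsWalk-reverse (y ∷ xs) w)) (Adj-sym G a , tt))
    where
    eq : reverse (x ∷ y ∷ xs) ≡ (reverse xs ++ [ y ]) ++ [ x ]
    eq = trans (unfold-reverse x (y ∷ xs)) (cong (_++ [ x ]) (unfold-reverse y xs))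

  IsWalk-reverse-ends : ∀ {x} xs {y} → IsWalk (x ∷ xs ++ [ y ]) → IsWalk (y ∷ reverse xs ++ [ x ])
  IsWalk-reverse-ends {x} xs {y} w = subst IsWalk (reverse-ends x xs y) (IsWalk-reverse (x ∷ xs ++ [ y ]) w)

  IsWalk⇒pairUp-edges : ∀ xs → IsWalk xs → All AdjE (pairUp xs)
  IsWalk⇒pairUp-edges []               _           = []
  IsWalk⇒pairUp-edges (x ∷ [])         _           = []
  IsWalk⇒pairUp-edges (x ∷ y ∷ [])     (a , _)     = a ∷ []
  IsWalk⇒pairUp-edges (x ∷ y ∷ z ∷ xs) (a , _ , w) = a ∷ IsWalk⇒pairUp-edges (z ∷ xs) w

  Edges : Set
  Edges = List (Fin n × Fin n)

  ∈⇒endpoints : ∀ {e : Fin n × Fin n} {M : Edges} → e ∈ M → proj₁ e ∈ endpoints M × proj₂ e ∈ endpoints M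
  ∈⇒endpoints (here refl) = here refl , there (here refl)
  ∈⇒endpoints (there m) with ∈⇒endpoints m
  ... | m₁ , m₂ = there (there m₁) , there (there m₂)

  IsEndpoint : Fin n → Fin n × Fin n → Set
  IsEndpoint z e = z ≡ proj₁ e ⊎ z ≡ proj₂ e

  endpoints⇒∈ : ∀ {z} (M : Edges) → z ∈ endpoints M → ∃ λ e → e ∈ M × IsEndpoint z e
  endpoints⇒∈ (e ∷ M) (here refl)         = e , here refl , inj₁ refl
  endpoints⇒∈ (e ∷ M) (there (here refl)) = e , here refl , inj₂ refl
  endpoints⇒∈ (e ∷ M) (there (there m)) with endpoints⇒∈ M m
  ... | f , f∈M , z∈f = f , there f∈M , z∈f

  endpoints-⊆ : ∀ {M M′ : Edges} → (∀ {e} → e ∈ M → e ∈ M′) → ∀ {z} → z ∈ endpoints M → z ∈ endpoints M′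
  endpoints-⊆ {M} M⊆M′ m with endpoints⇒∈ M m
  ... | e , e∈M , inj₁ refl = proj₁ (∈⇒endpoints (M⊆M′ e∈M))
  ... | e , e∈M , inj₂ refl = proj₂ (∈⇒endpoints (M⊆M′ e∈M))

  Unique-endpoints⇒edge-unique : ∀ {M : Edges} → Unique (endpoints M) → ∀ {e₁ e₂ z} → e₁ ∈ M → e₂ ∈ M →
                                 IsEndpoint z e₁ → IsEndpoint z e₂ → e₁ ≡ e₂
  Unique-endpoints⇒edge-unique {e ∷ M} u (here refl) (here refl) _ _ = refl
  Unique-endpoints⇒edge-unique {e ∷ M} u (here refl) (there e₂∈M) z∈e z∈e₂ = ⊥-elim (z∉M z∈e (z∈M z∈e₂))
    where
    z∈M : ∀ {z} → IsEndpoint z _ → z ∈ endpoints M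
    z∈M (inj₁ refl) = proj₁ (∈⇒endpoints e₂∈M)
    z∈M (inj₂ refl) = proj₂ (∈⇒endpoints e₂∈M)
    z∉M : ∀ {z} → IsEndpoint z e → z ∉ endpoints M
    z∉M (inj₁ refl) m = Unique[x∷xs]⇒x∉xs u (there m)
    z∉M (inj₂ refl) m = Unique[x∷xs]⇒x∉xs (AllPairs.tail u) m
  Unique-endpoints⇒edge-unique {e ∷ M} u (there e₁∈M) (here refl) z∈e₁ z∈e =
    sym (Unique-endpoints⇒edge-unique {e ∷ M} u (here refl) (there e₁∈M) z∈e z∈e₁)
  Unique-endpoints⇒edge-unique {e ∷ M} u (there e₁∈M) (there e₂∈M) z∈e₁ z∈e₂ =
    Unique-endpoints⇒edge-unique (AllPairs.tail (AllPairs.tail u)) e₁∈M e₂∈M z∈e₁ z∈e₂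

  Unique-endpoints-filter : ∀ {P : Fin n × Fin n → Set} (P? : Decidable P) (M : Edges) →
                            Unique (endpoints M) → Unique (endpoints (filter P? M))
  Unique-endpoints-filter P? []      u = u
  Unique-endpoints-filter P? (e ∷ M) u with does (P? e)
  ... | false = Unique-endpoints-filter P? M (AllPairs.tail (AllPairs.tail u))
  ... | true  = Unique-∷ (λ { (here refl) → Unique[x∷xs]⇒x∉xs u (here refl)
                            ; (there m)   → Unique[x∷xs]⇒x∉xs u (there (filtered m)) })
               (Unique-∷ (λ m → Unique[x∷xs]⇒x∉xs (AllPairs.tail u) (filtered m))
                 (Unique-endpoints-filter P? M (AllPairs.tail (AllPairs.tail u))))
    where
    filtered : ∀ {z} → z ∈ endpoints (filter P? M) → z ∈ endpoints M
    filtered = endpoints-⊆ {filter P? M} {M} (λ m → proj₁ (∈-filter⁻ P? m))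

  length-filter-∁ : ∀ {P : Fin n × Fin n → Set} (P? : Decidable P) (M : Edges) →
                    length (filter (¬? ∘ P?) M) + length (filter P? M) ≡ length M
  length-filter-∁ P? []      = refl
  length-filter-∁ P? (e ∷ M) with does (P? e)
  ... | true  = trans (+-suc _ _) (cong suc (length-filter-∁ P? M))
  ... | false = cong suc (length-filter-∁ P? M)

  ∈E-sym : ∀ {M : Edges} {u v} → (u , v) ∈E M → (v , u) ∈E M
  ∈E-sym = Sum.swap

  ∈E⇒Saturated : ∀ {M : Edges} {u v} → (u , v) ∈E M → Saturated M u
  ∈E⇒Saturated (inj₁ m) = proj₁ (∈⇒endpoints m)
  ∈E⇒Saturated (inj₂ m) = proj₂ (∈⇒endpoints m)

  Saturated⇒mate : ∀ {M : Edges} {u} → Saturated M u → ∃ λ v → (u , v) ∈E M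
  Saturated⇒mate {M} m with endpoints⇒∈ M m
  ... | (a , b) , e∈M , inj₁ refl = b , inj₁ e∈M
  ... | (a , b) , e∈M , inj₂ refl = a , inj₂ e∈M

  ∈E⇒Adj : ∀ {M} → IsMatching G M → ∀ {u v} → (u , v) ∈E M → Adj G u v
  ∈E⇒Adj (adj , _) (inj₁ m) = All.lookup adj m
  ∈E⇒Adj (adj , _) (inj₂ m) = Adj-sym G (All.lookup adj m)

  mate-unique : ∀ {M} → IsMatching G M → ∀ {u v w} → (u , v) ∈E M → (u , w) ∈E M → v ≡ w
  mate-unique (_ , u) (inj₁ m₁) (inj₁ m₂) = cong proj₂ (Unique-endpoints⇒edge-unique u m₁ m₂ (inj₁ refl) (inj₁ refl))
  mate-unique (_ , u) (inj₁ m₁) (inj₂ m₂) with Unique-endpoints⇒edge-unique u m₁ m₂ (inj₁ refl) (inj₂ refl)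
  ... | refl = refl
  mate-unique (_ , u) (inj₂ m₁) (inj₁ m₂) with Unique-endpoints⇒edge-unique u m₁ m₂ (inj₂ refl) (inj₁ refl)
  ... | refl = refl
  mate-unique (_ , u) (inj₂ m₁) (inj₂ m₂) = cong proj₁ (Unique-endpoints⇒edge-unique u m₁ m₂ (inj₂ refl) (inj₂ refl))

  MClosed : Edges → List (Fin n) → Set
  MClosed M L = ∀ {u v} → (u , v) ∈E M → u ∈ L → v ∈ L

  startsIn? : (L : List (Fin n)) → Decidable (λ (e : Fin n × Fin n) → proj₁ e ∈ L)
  startsIn? L e = proj₁ e ∈? L

  -- For M-closed L, inside L M holds the M-edges within L and outside L M those disjoint from L.
  inside outside : List (Fin n) → Edges → Edges
  inside  L = filter (startsIn? L)
  outside L = filter (¬? ∘ startsIn? L)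

  ∈-inside⁻ : ∀ L M {e} → e ∈ inside L M → e ∈ M × proj₁ e ∈ L
  ∈-inside⁻ L M = ∈-filter⁻ (startsIn? L) {xs = M}

  ∈-outside⁻ : ∀ L M {e} → e ∈ outside L M → e ∈ M × proj₁ e ∉ L
  ∈-outside⁻ L M = ∈-filter⁻ (¬? ∘ startsIn? L) {xs = M}

  inside-endpoints : ∀ {M} L → MClosed M L → ∀ {z} → z ∈ endpoints (inside L M) → z ∈ L
  inside-endpoints {M} L cl m with endpoints⇒∈ (inside L M) m
  ... | e , e∈ , inj₁ refl = proj₂ (∈-inside⁻ L M e∈)
  ... | e , e∈ , inj₂ refl = cl (inj₁ (proj₁ (∈-inside⁻ L M e∈))) (proj₂ (∈-inside⁻ L M e∈))

  outside-endpoints : ∀ {M} L → MClosed M L → ∀ {z} → z ∈ endpoints (outside L M) → z ∉ L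
  outside-endpoints {M} L cl m z∈L with endpoints⇒∈ (outside L M) m
  ... | e , e∈ , inj₁ refl = proj₂ (∈-outside⁻ L M e∈) z∈L
  ... | e , e∈ , inj₂ refl = proj₂ (∈-outside⁻ L M e∈) (cl (inj₂ (proj₁ (∈-outside⁻ L M e∈))) z∈L)

  rematch-isMatching : ∀ {M N L} → IsMatching G M → All AdjE N → Unique (endpoints N) →
    (∀ {z} → z ∈ endpoints N → z ∈ L) → MClosed M L → IsMatching G (N ++ outside L M)
  rematch-isMatching {M} {N} {L} (adj , u) adjN uN N⊆L cl =
    AllP.++⁺ adjN (AllP.filter⁺ (¬? ∘ startsIn? L) adj) ,
    subst Unique (sym (endpoints-++ N (outside L M)))
      (++⁺ uN (Unique-endpoints-filter (¬? ∘ startsIn? L) M u) (λ (m₁ , m₂) → outside-endpoints L cl m₂ (N⊆L m₁)))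

  inside-bound : ∀ {M} L → IsMatching G M → MClosed M L → ∀ X → Unique X →
    (∀ {x} → x ∈ X → x ∈ L × ¬ Saturated M x) →
    length X + (length (inside L M) + length (inside L M)) ≤ length L
  inside-bound {M} L (_ , u) cl X uX X⊆L = begin
    length X + (length (inside L M) + length (inside L M)) ≡⟨ cong (length X +_) (sym (length-endpoints (inside L M))) ⟩
    length X + length (endpoints (inside L M))            ≡⟨ sym (length-++ X) ⟩
    length (X ++ endpoints (inside L M))                  ≤⟨ Unique⇒length≤ uXI XI⊆L ⟩
    length L                                              ∎
    where
    open ≤-Reasoning
    uXI : Unique (X ++ endpoints (inside L M))
    uXI = ++⁺ uX (Unique-endpoints-filter (startsIn? L) M u)
              (λ (x∈X , m) → proj₂ (X⊆L x∈X) (endpoints-⊆ (λ e∈ → proj₁ (∈-inside⁻ L M e∈)) m))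
    XI⊆L : ∀ {z} → z ∈ X ++ endpoints (inside L M) → z ∈ L
    XI⊆L m with ∈-++⁻ X m
    ... | inj₁ x∈X = proj₁ (X⊆L x∈X)
    ... | inj₂ m′  = inside-endpoints L cl m′

  rematch-gain : ∀ {N} L M k → length (inside L M) + k ≤ length N → length M + k ≤ length (N ++ outside L M)
  rematch-gain {N} L M k h = begin
    length M + k                                     ≡⟨ cong (_+ k) (sym (length-filter-∁ (startsIn? L) M)) ⟩
    length (outside L M) + length (inside L M) + k   ≡⟨ +-assoc (length (outside L M)) _ k ⟩
    length (outside L M) + (length (inside L M) + k) ≤⟨ +-monoʳ-≤ (length (outside L M)) h ⟩
    length (outside L M) + length N                  ≡⟨ +-comm _ (length N) ⟩
    length N + length (outside L M)                  ≡⟨ sym (length-++ N) ⟩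
    length (N ++ outside L M)                        ∎
    where open ≤-Reasoning

  -- z is missed by the maximum matching obtained from M by matching R along pairUp R instead.
  Dset-by-rematching : ∀ {M} → IsMaxMatching G M → ∀ z R → Unique (z ∷ R) → isOdd (length R) ≡ false →
    All AdjE (pairUp R) → MClosed M (z ∷ R) → Dset G z
  Dset-by-rematching {M} (isM , maxM) z R u even adjN cl =
    M′ , (isM′ , λ M″ isM″ → ≤-trans (maxM M″ isM″) |M|≤|M′|) , z-exposed
    where
    N  = pairUp R
    L  = z ∷ R
    M′ = N ++ outside L M
    endpointsN : endpoints N ≡ R
    endpointsN = endpoints-pairUp R even
    isM′ : IsMatching G M′
    isM′ = rematch-isMatching isM adjN (subst Unique (sym endpointsN) (AllPairs.tail u))
             (λ m → there (subst (_ ∈_) endpointsN m)) cl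
    |inside|≤|N| : length (inside L M) ≤ length N
    |inside|≤|N| = half-≤ _ _ (subst (λ k → length (inside L M) + length (inside L M) ≤ suc k)
                     (sym (length-pairUp R even)) (inside-bound L isM cl [] [] (λ ())))
    |M|≤|M′| : length M ≤ length M′
    |M|≤|M′| = subst (_≤ length M′) (+-identityʳ (length M))
                 (rematch-gain {N} L M 0 (subst (_≤ length N) (sym (+-identityʳ _)) |inside|≤|N|))
    z-exposed : ¬ Saturated M′ z
    z-exposed m with ∈-++⁻ (endpoints N) (subst (z ∈_) (endpoints-++ N (outside L M)) m)
    ... | inj₁ m₁ = Unique[x∷xs]⇒x∉xs u (subst (z ∈_) endpointsN m₁)
    ... | inj₂ m₂ = outside-endpoints L cl m₂ (here refl)

  -- Otherwise rematching L along pairUp L would give a matching larger than M.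
  exposed-pair⇒¬rematchable : ∀ {M} → IsMaxMatching G M → ∀ L → Unique L → isOdd (length L) ≡ false →
    All AdjE (pairUp L) → MClosed M L → ∀ {y w} → y ∈ L → w ∈ L → y ≢ w →
    ¬ Saturated M y → ¬ Saturated M w → ⊥
  exposed-pair⇒¬rematchable {M} (isM , maxM) L u even adjN cl {y} {w} y∈L w∈L y≢w y-exposed w-exposed =
    <-irrefl refl (≤-trans |M|<|M′| (maxM M′ isM′))
    where
    N  = pairUp L
    M′ = N ++ outside L M
    i  = length (inside L M)
    endpointsN : endpoints N ≡ L
    endpointsN = endpoints-pairUp L even
    isM′ : IsMatching G M′
    isM′ = rematch-isMatching isM adjN (subst Unique (sym endpointsN) u) (subst (_ ∈_) endpointsN) cl
    yw : ∀ {x} → x ∈ y ∷ w ∷ [] → x ∈ L × ¬ Saturated M x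
    yw (here refl)         = y∈L , y-exposed
    yw (there (here refl)) = w∈L , w-exposed
    bound : suc i + suc i ≤ length N + length N
    bound = subst₂ _≤_ (cong suc (sym (+-suc i i))) (sym (length-pairUp L even))
              (inside-bound L isM cl (y ∷ w ∷ []) (Unique-∷ (λ { (here refl) → y≢w refl }) ([] ∷ [])) yw)
    |M|<|M′| : suc (length M) ≤ length M′
    |M|<|M′| = subst (_≤ length M′) (+-comm (length M) 1)
                 (rematch-gain {N} L M 1 (subst (_≤ length N) (+-comm 1 i) (half-≤ (suc i) (length N) (m≤n⇒m≤1+n bound))))

  flips : ℕ → Bool → Bool
  flips zero    b = b
  flips (suc k) b = flips k (not b)

  flips-isOdd : ∀ k b → flips k b ≡ b xor isOdd k
  flips-isOdd zero    b = sym (xor-identityʳ b)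
  flips-isOdd (suc k) b = trans (flips-isOdd k (not b)) (not-xor-swap b (isOdd k))
    where
    not-xor-swap : ∀ a c → not a xor c ≡ a xor not c
    not-xor-swap true  c = sym (not-involutive c)
    not-xor-swap false c = refl

  flips-even : ∀ k b → isOdd k ≡ false → flips k b ≡ b
  flips-even k b e = trans (flips-isOdd k b) (trans (cong (b xor_) e) (xor-identityʳ b))

  flips-odd : ∀ k b → isOdd k ≡ true → flips k b ≡ not b
  flips-odd k b e = trans (flips-isOdd k b) (trans (cong (b xor_) e) (xor-true b))
    where
    xor-true : ∀ a → a xor true ≡ not a
    xor-true true  = refl
    xor-true false = refl

  -- Only the M-steps of an alternating walk are constrained; its other steps are arbitrary edges of G.
  Step : Edges → Bool → Fin n → Fin n → Set
  Step M true  u v = (u , v) ∈E M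
  Step M false u v = Adj G u v

  AltWalk : Edges → Bool → List (Fin n) → Set
  AltWalk M b (u ∷ v ∷ xs) = Step M b u v × AltWalk M (not b) (v ∷ xs)
  AltWalk M b _            = ⊤

  AltWalk⇒IsWalk : ∀ {M} → IsMatching G M → ∀ b xs → AltWalk M b xs → IsWalk xs
  AltWalk⇒IsWalk isM b     []           _       = tt
  AltWalk⇒IsWalk isM b     (x ∷ [])     _       = tt
  AltWalk⇒IsWalk isM true  (x ∷ y ∷ xs) (s , w) = ∈E⇒Adj isM s , AltWalk⇒IsWalk isM false (y ∷ xs) w
  AltWalk⇒IsWalk isM false (x ∷ y ∷ xs) (s , w) = s , AltWalk⇒IsWalk isM true (y ∷ xs) w

  AltWalk⇒pairUp-edges : ∀ {M} xs → AltWalk M false xs → All AdjE (pairUp xs)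
  AltWalk⇒pairUp-edges []               _           = []
  AltWalk⇒pairUp-edges (x ∷ [])         _           = []
  AltWalk⇒pairUp-edges (x ∷ y ∷ [])     (a , _)     = a ∷ []
  AltWalk⇒pairUp-edges (x ∷ y ∷ z ∷ xs) (a , _ , w) = a ∷ AltWalk⇒pairUp-edges (z ∷ xs) w

  AltWalk-split : ∀ {M} b xs {y} ys → AltWalk M b (xs ++ y ∷ ys) →
                  AltWalk M b (xs ++ [ y ]) × AltWalk M (flips (length xs) b) (y ∷ ys)
  AltWalk-split b []            ys w       = tt , w
  AltWalk-split b (x ∷ [])      ys (s , w) = (s , tt) , w
  AltWalk-split b (x ∷ x′ ∷ xs) ys (s , w) with AltWalk-split (not b) (x′ ∷ xs) ys w
  ... | w₁ , w₂ = (s , w₁) , w₂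

  AltWalk-join : ∀ {M} b xs {y} ys → AltWalk M b (xs ++ [ y ]) → AltWalk M (flips (length xs) b) (y ∷ ys) →
                 AltWalk M b (xs ++ y ∷ ys)
  AltWalk-join b []            ys _        w = w
  AltWalk-join b (x ∷ [])      ys (s , _)  w = s , w
  AltWalk-join b (x ∷ x′ ∷ xs) ys (s , w₁) w = s , AltWalk-join (not b) (x′ ∷ xs) ys w₁ w

  AltWalk-suffix : ∀ {M} b A {u} B → AltWalk M b (A ++ u ∷ B) → AltWalk M (flips (length A) b) (u ∷ B)
  AltWalk-suffix b A B w = proj₂ (AltWalk-split b A B w)

  AltWalk-step : ∀ {M} b A {u v} B → AltWalk M b (A ++ u ∷ v ∷ B) → Step M (flips (length A) b) u v
  AltWalk-step b A {v = v} B w = proj₁ (AltWalk-suffix b A (v ∷ B) w)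

  lastOf : Fin n → List (Fin n) → Fin n
  lastOf h []      = h
  lastOf h (x ∷ t) = lastOf x t

  lastOf-∈ : ∀ h t → lastOf h t ∈ h ∷ t
  lastOf-∈ h []      = here refl
  lastOf-∈ h (x ∷ t) = there (lastOf-∈ x t)

  lastOf-++ : ∀ h xs y ys → lastOf h (xs ++ y ∷ ys) ≡ lastOf y ys
  lastOf-++ h []       y ys = refl
  lastOf-++ h (x ∷ xs) y ys = lastOf-++ x xs y ys

  last≡lastOf : ∀ h t → last (h ∷ t) ≡ just (lastOf h t)
  last≡lastOf h []      = refl
  last≡lastOf h (x ∷ t) = last≡lastOf x t

  -- Along an alternating walk the M-mate of every inner vertex is one of its two neighbours on the walk.
  AltWalk-MClosed : ∀ {M} → IsMatching G M → ∀ b h t L → AltWalk M b (h ∷ t) → (∀ {z} → z ∈ h ∷ t → z ∈ L) →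
    (b ≡ false → ∀ {z} → (h , z) ∈E M → z ∈ L) → (∀ {z} → (lastOf h t , z) ∈E M → z ∈ L) →
    ∀ {u z} → u ∈ h ∷ t → (u , z) ∈E M → z ∈ L
  AltWalk-MClosed isM b     h []      L _       _    _     last-mate (here refl) m = last-mate m
  AltWalk-MClosed isM true  h (v ∷ t) L (s , w) walk⊆ _     last-mate (here refl) m
    rewrite mate-unique isM m s = walk⊆ (there (here refl))
  AltWalk-MClosed isM false h (v ∷ t) L (s , w) walk⊆ h-mate last-mate (here refl) m = h-mate refl m
  AltWalk-MClosed {M} isM true h (v ∷ t) L (s , w) walk⊆ _ last-mate (there u∈) m =
    AltWalk-MClosed isM false v t L w (walk⊆ ∘ there) v-mate last-mate u∈ m
    where
    v-mate : false ≡ false → ∀ {z} → (v , z) ∈E M → z ∈ L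
    v-mate _ m′ rewrite mate-unique isM m′ (∈E-sym s) = walk⊆ (here refl)
  AltWalk-MClosed isM false h (v ∷ t) L (s , w) walk⊆ _ last-mate (there u∈) m =
    AltWalk-MClosed isM true v t L w (walk⊆ ∘ there) (λ ()) last-mate u∈ m

  mutual
    Alternating⇒AltWalk-M : ∀ {M} u v xs → Alternating M (pairs (u ∷ v ∷ xs)) → IsWalk (u ∷ v ∷ xs) →
                            (u , v) ∈E M → AltWalk M true (u ∷ v ∷ xs)
    Alternating⇒AltWalk-M u v []       _              _          m = m , tt
    Alternating⇒AltWalk-M u v (w ∷ xs) (next , _ , al) (_ , walk) m = m , Alternating⇒AltWalk-¬M v w xs al walk (next m)

    Alternating⇒AltWalk-¬M : ∀ {M} u v xs → Alternating M (pairs (u ∷ v ∷ xs)) → IsWalk (u ∷ v ∷ xs) →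
                             ¬ (u , v) ∈E M → AltWalk M false (u ∷ v ∷ xs)
    Alternating⇒AltWalk-¬M u v []       _              (a , _)    _  = a , tt
    Alternating⇒AltWalk-¬M u v (w ∷ xs) (_ , next , al) (a , walk) ¬m = a , Alternating⇒AltWalk-M v w xs al walk (next ¬m)

  Alternating-last-Saturated : ∀ {M} u v w xs → Alternating M (pairs (u ∷ v ∷ w ∷ xs)) → ¬ (u , v) ∈E M →
                               isOdd (length xs) ≡ false → Saturated M (lastOf u (v ∷ w ∷ xs))
  Alternating-last-Saturated u v w []           (_ , next , _) ¬m _ = ∈E⇒Saturated (∈E-sym (next ¬m))
  Alternating-last-Saturated u v w (x ∷ y ∷ xs) (_ , next , next′ , _ , al) ¬m e =
    Alternating-last-Saturated w x y xs al (next′ (next ¬m)) (isOdd-suc-suc (length xs) e)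

  ∈-cycEdges⇒∈ : ∀ {u v : Fin n} C → (u , v) ∈ cycEdges C → u ∈ C × v ∈ C
  ∈-cycEdges⇒∈ (h ∷ t) m with ∈-pairs⇒∈ ((h ∷ t) ++ [ h ]) m
  ... | u∈ , v∈ = drop-h u∈ , drop-h v∈
    where
    drop-h : ∀ {z} → z ∈ (h ∷ t) ++ [ h ] → z ∈ h ∷ t
    drop-h m′ with ∈-++⁻ (h ∷ t) m′
    ... | inj₁ z∈         = z∈
    ... | inj₂ (here refl) = here refl

  ∈E-cycEdges⇒∈ : ∀ {u v : Fin n} C → (u , v) ∈E cycEdges C → u ∈ C × v ∈ C
  ∈E-cycEdges⇒∈ C (inj₁ m) = ∈-cycEdges⇒∈ C m
  ∈E-cycEdges⇒∈ C (inj₂ m) = swap (∈-cycEdges⇒∈ C m)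

  countM : Edges → List (Fin n × Fin n) → ℕ
  countM M es = length (filter (_∈E? M) es)

  countM-∷-∈ : ∀ {M e} es → e ∈E M → countM M (e ∷ es) ≡ suc (countM M es)
  countM-∷-∈ {M} es m = cong length (filter-accept (_∈E? M) m)

  countM-∷-∉ : ∀ {M e} es → ¬ e ∈E M → countM M (e ∷ es) ≡ countM M es
  countM-∷-∉ {M} es ¬m = cong length (filter-reject (_∈E? M) ¬m)

  countM-++ : ∀ M xs ys → countM M (xs ++ ys) ≡ countM M xs + countM M ys
  countM-++ M xs ys = trans (cong length (filter-++ (_∈E? M) xs ys)) (length-++ (filter (_∈E? M) xs))

  pairs-∷ʳ : ∀ (h : Fin n) t y → pairs ((h ∷ t) ++ [ y ]) ≡ pairs (h ∷ t) ++ [ (lastOf h t , y) ]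
  pairs-∷ʳ h []      y = refl
  pairs-∷ʳ h (x ∷ t) y = cong ((h , x) ∷_) (pairs-∷ʳ x t y)

  record Rotation (C : List (Fin n)) (y : Fin n) : Set where
    field
      K        : List (Fin n)
      ⊆rotated : ∀ {z} → z ∈ C → z ∈ y ∷ K
      rotated⊆ : ∀ {z} → z ∈ y ∷ K → z ∈ C
      unique   : Unique (y ∷ K)
      edges⊆   : ∀ {e} → e ∈ cycEdges (y ∷ K) → e ∈ cycEdges C
      countM≡  : ∀ M → countM M (cycEdges (y ∷ K)) ≡ countM M (cycEdges C)
      length≡  : length (y ∷ K) ≡ length C

  rotate : ∀ {C y} → Unique C → y ∈ C → Rotation C y
  rotate {C} {y} uC y∈C with ∈-∃++ y∈C
  ... | [] , Z , refl = record
    { K = Z ; ⊆rotated = id ; rotated⊆ = id ; unique = uC ; edges⊆ = id ; countM≡ = λ _ → refl ; length≡ = refl }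
  ... | x ∷ X , Z , refl = record
    { K        = Z ++ x ∷ X
    ; ⊆rotated = ⊆rotated
    ; rotated⊆ = rotated⊆
    ; unique   = ++⁺ (Unique-++⁻ʳ (x ∷ X) uC) (Unique-++⁻ˡ (x ∷ X) uC)
                     (λ (m₁ , m₂) → Unique-++⇒Disjoint (x ∷ X) uC (m₂ , m₁))
    ; edges⊆   = λ {e} m → subst (e ∈_) (sym edgesC) (++-comm-∈ P₂ P₁ (subst (e ∈_) edgesR m))
    ; countM≡  = λ M → begin
        countM M (cycEdges (y ∷ Z ++ x ∷ X)) ≡⟨ cong (countM M) edgesR ⟩
        countM M (P₂ ++ P₁)                  ≡⟨ countM-++ M P₂ P₁ ⟩
        countM M P₂ + countM M P₁            ≡⟨ +-comm (countM M P₂) (countM M P₁) ⟩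
        countM M P₁ + countM M P₂            ≡⟨ sym (countM-++ M P₁ P₂) ⟩
        countM M (P₁ ++ P₂)                  ≡⟨ cong (countM M) (sym edgesC) ⟩
        countM M (cycEdges ((x ∷ X) ++ y ∷ Z)) ∎
    ; length≡  = begin
        suc (length (Z ++ x ∷ X))       ≡⟨ cong suc (length-++ Z) ⟩
        suc (length Z + suc (length X)) ≡⟨ cong suc (+-comm (length Z) (suc (length X))) ⟩
        suc (suc (length X + length Z)) ≡⟨ cong suc (sym (+-suc (length X) (length Z))) ⟩
        suc (length X + suc (length Z)) ≡⟨ cong suc (sym (length-++ X)) ⟩
        length ((x ∷ X) ++ y ∷ Z)       ∎
    }
    where
    open ≡-Reasoning
    P₁ = pairs (x ∷ X ++ [ y ])
    P₂ = pairs (y ∷ Z ++ [ x ])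
    edgesC : cycEdges ((x ∷ X) ++ y ∷ Z) ≡ P₁ ++ P₂
    edgesC = trans (cong (λ l → pairs (x ∷ l)) (++-assoc X (y ∷ Z) [ x ])) (pairs-++-∷ (x ∷ X) y (Z ++ [ x ]))
    edgesR : cycEdges (y ∷ Z ++ x ∷ X) ≡ P₂ ++ P₁
    edgesR = trans (cong (λ l → pairs (y ∷ l)) (++-assoc Z (x ∷ X) [ y ])) (pairs-++-∷ (y ∷ Z) x (X ++ [ y ]))
    ++-comm-∈ : ∀ {A : Set} {a : A} xs ys → a ∈ xs ++ ys → a ∈ ys ++ xs
    ++-comm-∈ xs ys m with ∈-++⁻ xs m
    ... | inj₁ m₁ = ∈-++⁺ʳ ys m₁
    ... | inj₂ m₂ = ∈-++⁺ˡ m₂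
    ⊆rotated : ∀ {z} → z ∈ (x ∷ X) ++ y ∷ Z → z ∈ y ∷ Z ++ x ∷ X
    ⊆rotated m with ∈-++⁻ (x ∷ X) m
    ... | inj₁ m₁         = there (∈-++⁺ʳ Z m₁)
    ... | inj₂ (here refl) = here refl
    ... | inj₂ (there m₂)  = there (∈-++⁺ˡ m₂)
    rotated⊆ : ∀ {z} → z ∈ y ∷ Z ++ x ∷ X → z ∈ (x ∷ X) ++ y ∷ Z
    rotated⊆ (here refl) = ∈-++⁺ʳ (x ∷ X) (here refl)
    rotated⊆ (there m) with ∈-++⁻ Z m
    ... | inj₁ m₁ = ∈-++⁺ʳ (x ∷ X) (there m₁)
    ... | inj₂ m₂ = ∈-++⁺ˡ m₂

  countM-after-M-edge : ∀ {M} → IsMatching G M → ∀ {w₀ w₁} ws → Unique (w₀ ∷ w₁ ∷ ws) → (w₀ , w₁) ∈E M →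
                        countM M (pairs (w₀ ∷ w₁ ∷ ws)) ≡ suc (countM M (pairs ws))
  countM-after-M-edge isM []       u m = countM-∷-∈ [] m
  countM-after-M-edge {M} isM {w₀} {w₁} (w₂ ∷ ws) u m = trans (countM-∷-∈ _ m) (cong suc (countM-∷-∉ _ ¬m))
    where
    ¬m : ¬ (w₁ , w₂) ∈E M
    ¬m m₂ with mate-unique isM (∈E-sym m) m₂
    ... | refl = Unique[x∷xs]⇒x∉xs u (there (here refl))

  countM-pairs-bound : ∀ {M} → IsMatching G M → ∀ ws → Unique ws → countM M (pairs ws) + countM M (pairs ws) ≤ length ws
  countM-pairs-bound isM []       _ = z≤n
  countM-pairs-bound isM (w ∷ []) _ = z≤n
  countM-pairs-bound {M} isM (w₀ ∷ w₁ ∷ ws) u =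
    extend ((w₀ , w₁) ∈E? M) (countM-pairs-bound isM (w₁ ∷ ws) (AllPairs.tail u))
           (countM-pairs-bound isM ws (AllPairs.tail (AllPairs.tail u)))
    where
    k₁ = countM M (pairs (w₁ ∷ ws))
    k₂ = countM M (pairs ws)
    extend : Dec ((w₀ , w₁) ∈E M) → k₁ + k₁ ≤ length (w₁ ∷ ws) → k₂ + k₂ ≤ length ws →
             countM M (pairs (w₀ ∷ w₁ ∷ ws)) + countM M (pairs (w₀ ∷ w₁ ∷ ws)) ≤ length (w₀ ∷ w₁ ∷ ws)
    extend (no ¬m) b₁ _ = subst (λ k → k + k ≤ length (w₀ ∷ w₁ ∷ ws)) (sym (countM-∷-∉ {M} (pairs (w₁ ∷ ws)) ¬m))
                            (m≤n⇒m≤1+n b₁)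
    extend (yes m) _ b₂ = subst (λ k → k + k ≤ length (w₀ ∷ w₁ ∷ ws)) (sym (countM-after-M-edge isM ws u m))
                            (s≤s (subst (_≤ suc (length ws)) (sym (+-suc k₂ k₂)) (s≤s b₂)))

  countM-pairs-cover : ∀ {M} → IsMatching G M → ∀ ws → Unique ws → ∀ l → length ws ≡ l + l → l ≤ countM M (pairs ws) →
                       ∀ {v} → v ∈ ws → ∃ λ z → z ∈ ws × (v , z) ∈E M
  countM-pairs-cover isM (w ∷ [])       _ zero    ()
  countM-pairs-cover isM (w ∷ [])       _ (suc l) eq _ _ = ⊥-elim (0≢1+n (trans (suc-injective eq) (+-suc l l)))
  countM-pairs-cover isM (w₀ ∷ w₁ ∷ ws) _ zero    ()
  countM-pairs-cover {M} isM (w₀ ∷ w₁ ∷ ws) u (suc l) eq l≤ v∈ with (w₀ , w₁) ∈E? M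
  ... | no ¬m = contradiction (subst (suc l ≤_) (countM-∷-∉ {M} (pairs (w₁ ∷ ws)) ¬m) l≤) (<⇒≱ (s≤s k≤l))
    where
    k = countM M (pairs (w₁ ∷ ws))
    k≤l : k ≤ l
    k≤l = half-≤ k l (subst (k + k ≤_) (cong suc |ws|) (countM-pairs-bound isM (w₁ ∷ ws) (AllPairs.tail u)))
      where |ws| = suc-injective (trans (suc-injective eq) (+-suc l l))
  ... | yes m with v∈
  ...   | here refl         = w₁ , there (here refl) , m
  ...   | there (here refl) = w₀ , here refl , ∈E-sym m
  ...   | there (there v∈ws) with countM-pairs-cover isM ws (AllPairs.tail (AllPairs.tail u)) l
                                    (suc-injective (trans (suc-injective eq) (+-suc l l)))
                                    (≤-pred (subst (suc l ≤_) (countM-after-M-edge isM ws u m) l≤)) v∈ws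
  ...     | z , z∈ , vz = z , there (there z∈) , vz

  -- No cycle edge at the base is in M, so the k M-edges of C lie on the path C − c of 2k vertices and cover it.
  blossom-mate : ∀ {M} → IsMatching G M → ∀ {C c} → Unique C → IsBlossom M C → IsBase M C c → 3 ≤ length C →
                 ∀ {v} → v ∈ C → v ≢ c → ∃ λ z → z ∈ C × (v , z) ∈E M
  blossom-mate {M} isM {C} {c} uC blossom (c∈C , uncovered) long {v} v∈C v≢c = go (rotate uC c∈C)
    where
    m = cycMEdges M C
    go : Rotation C c → ∃ λ z → z ∈ C × (v , z) ∈E M
    go record { K = [] ; length≡ = eq } = contradiction (subst (3 ≤_) (sym eq) long) λ { (s≤s ()) }
    go record { K = k ∷ K ; ⊆rotated = ⊆rot ; rotated⊆ = rot⊆ ; unique = u ; edges⊆ = e⊆ ; countM≡ = cnt ; length≡ = len }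
      = mate (⊆rot v∈C)
      where
      first-not-M : ¬ (c , k) ∈E M
      first-not-M e = proj₁ (uncovered c k (e⊆ (here refl)) e) refl
      P = pairs (k ∷ K)
      last-edge = (lastOf k K , c)
      last-not-M : ¬ last-edge ∈E M
      last-not-M e = proj₂ (uncovered (lastOf k K) c
                       (e⊆ (there (subst (last-edge ∈_) (sym (pairs-∷ʳ k K c)) (∈-++⁺ʳ P (here refl))))) e) refl
      countK : countM M P ≡ m
      countK = begin
        countM M P                                ≡⟨ sym (+-identityʳ _) ⟩
        countM M P + 0                            ≡⟨ cong (countM M P +_) (sym (countM-∷-∉ [] last-not-M)) ⟩
        countM M P + countM M [ last-edge ]       ≡⟨ sym (countM-++ M P _) ⟩
        countM M (P ++ [ last-edge ])             ≡⟨ cong (countM M) (sym (pairs-∷ʳ k K c)) ⟩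
        countM M (pairs ((k ∷ K) ++ [ c ]))       ≡⟨ sym (countM-∷-∉ _ first-not-M) ⟩
        countM M (cycEdges (c ∷ k ∷ K))           ≡⟨ cnt M ⟩
        m                                         ∎
        where open ≡-Reasoning
      K-length : length (k ∷ K) ≡ m + m
      K-length = suc-injective (trans len (trans (sym blossom) (cong suc (cong (m +_) (+-identityʳ m)))))
      mate : v ∈ c ∷ k ∷ K → ∃ λ z → z ∈ C × (v , z) ∈E M
      mate (here v≡c) = ⊥-elim (v≢c v≡c)
      mate (there v∈K) with countM-pairs-cover isM (k ∷ K) (AllPairs.tail u) m K-length (≤-reflexive (sym countK)) v∈K
      ... | z , z∈ , vz = z , rot⊆ (there z∈) , vz

  record EvenAltPath (M : Edges) (x : Fin n) : Set where
    field
      start         : Fin n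
      path          : List (Fin n)
      unique        : Unique (start ∷ path)
      alternating   : AltWalk M false (start ∷ path)
      odd-vertex-count    : isOdd (length (start ∷ path)) ≡ true
      start-exposed : ¬ Saturated M start
      ends-at       : lastOf start path ≡ x

  -- Follow the component of x in the symmetric difference of M and M′, starting with an M-edge.
  module SymmetricDifference {M M′ : Edges} (maxM : IsMaxMatching G M) (maxM′ : IsMaxMatching G M′)
                             {x : Fin n} (x-exposed′ : ¬ Saturated M′ x) where

    matching : Bool → Edges
    matching true  = M
    matching false = M′

    isMatching : ∀ t → IsMatching G (matching t)
    isMatching true  = proj₁ maxM
    isMatching false = proj₁ maxM′

    AltBoth : Bool → List (Fin n) → Set
    AltBoth b (u ∷ v ∷ xs) = (u , v) ∈E matching b × AltBoth (not b) (v ∷ xs)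
    AltBoth b _            = ⊤

    -- h ∷ r is the path found so far, listed backwards from its newest vertex h; the next edge is in matching t.
    record Growing (t : Bool) (h : Fin n) (r : List (Fin n)) : Set where
      field
        unique      : Unique (h ∷ r)
        mates-in    : ∀ {u z} → u ∈ h ∷ r → (u , z) ∈E matching (not t) → z ∈ h ∷ r
        mates-in′   : ∀ {u z} → u ∈ h ∷ r → u ≢ h → (u , z) ∈E matching t → z ∈ h ∷ r
        no-mate-h   : ∀ {u} → u ∈ h ∷ r → (u , h) ∈E matching t → ⊥
        alternating : AltBoth (not t) (h ∷ r)
        ends-at     : lastOf h r ≡ x
        parity      : isOdd (length (h ∷ r)) ≡ t

    no-loop : ∀ t {u} → (u , u) ∈E matching t → ⊥
    no-loop t m = irrefl G (∈E⇒Adj (isMatching t) m)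

    matching-not-not : ∀ t → matching (not (not t)) ≡ matching t
    matching-not-not t = cong matching (not-involutive t)

    begin-at-x : Growing true x []
    begin-at-x = record
      { unique      = [] ∷ []
      ; mates-in    = λ { (here refl) m → ⊥-elim (x-exposed′ (∈E⇒Saturated m)) }
      ; mates-in′   = λ { (here refl) x≢x _ → ⊥-elim (x≢x refl) }
      ; no-mate-h   = λ { (here refl) m → no-loop true m }
      ; alternating = tt
      ; ends-at     = refl
      ; parity      = refl
      }

    grow : ∀ t h r z → Growing t h r → (h , z) ∈E matching t → Growing (not t) z (h ∷ r)
    grow t h r z I m = record
      { unique      = Unique-∷ z∉ (Growing.unique I)
      ; mates-in    = mates-in
      ; mates-in′   = mates-in′
      ; no-mate-h   = no-mate-h
      ; alternating = subst (λ E → (z , h) ∈E E) (sym (matching-not-not t)) (∈E-sym m)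
                    , subst (λ b → AltBoth b (h ∷ r)) (sym (not-involutive (not t))) (Growing.alternating I)
      ; ends-at     = Growing.ends-at I
      ; parity      = cong not (Growing.parity I)
      }
      where
      z∉ : z ∉ h ∷ r
      z∉ z∈ = Growing.no-mate-h I z∈ (∈E-sym m)
      mates-in : ∀ {u v} → u ∈ z ∷ h ∷ r → (u , v) ∈E matching (not (not t)) → v ∈ z ∷ h ∷ r
      mates-in (here refl) m′
        rewrite mate-unique (isMatching t) (subst (λ E → (z , _) ∈E E) (matching-not-not t) m′) (∈E-sym m)
        = there (here refl)
      mates-in {u} (there u∈) m′ with u ≟ h
      ... | yes refl rewrite mate-unique (isMatching t) (subst (λ E → (h , _) ∈E E) (matching-not-not t) m′) m
        = here refl
      ... | no u≢h = there (Growing.mates-in′ I u∈ u≢h (subst (λ E → (u , _) ∈E E) (matching-not-not t) m′))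
      mates-in′ : ∀ {u v} → u ∈ z ∷ h ∷ r → u ≢ z → (u , v) ∈E matching (not t) → v ∈ z ∷ h ∷ r
      mates-in′ (here refl) u≢z _ = ⊥-elim (u≢z refl)
      mates-in′ (there u∈) _ m′  = there (Growing.mates-in I u∈ m′)
      no-mate-h : ∀ {u} → u ∈ z ∷ h ∷ r → (u , z) ∈E matching (not t) → ⊥
      no-mate-h (here refl) m′ = no-loop (not t) m′
      no-mate-h (there u∈) m′  = z∉ (Growing.mates-in I u∈ m′)

    Stuck : Set
    Stuck = ∃ λ t → ∃₂ λ h r → Growing t h r × ¬ Saturated (matching t) h

    -- The path has distinct vertices, so it gets stuck within n steps.
    grow-until-stuck : ∀ fuel t h r → Growing t h r → suc n ≤ length (h ∷ r) + fuel → Stuck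
    grow-until-stuck zero t h r I bound =
      ⊥-elim (<-irrefl refl (≤-trans (subst (suc n ≤_) (+-identityʳ _) bound) (Unique⇒length≤n (Growing.unique I))))
    grow-until-stuck (suc fuel) t h r I bound with h ∈? endpoints (matching t)
    ... | no  h-exposed = t , h , r , I , h-exposed
    ... | yes h-matched with Saturated⇒mate h-matched
    ...   | z , m = grow-until-stuck fuel (not t) z (h ∷ r) (grow t h r z I m)
                      (subst (suc n ≤_) (+-suc (length (h ∷ r)) fuel) bound)

    AltBoth⇒AltWalk : ∀ b xs → AltBoth b xs → AltWalk M b xs
    AltBoth⇒AltWalk b     []           _       = tt
    AltBoth⇒AltWalk b     (u ∷ [])     _       = tt
    AltBoth⇒AltWalk true  (u ∷ v ∷ xs) (m , a) = m , AltBoth⇒AltWalk false (v ∷ xs) a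
    AltBoth⇒AltWalk false (u ∷ v ∷ xs) (m , a) = ∈E⇒Adj (isMatching false) m , AltBoth⇒AltWalk true (v ∷ xs) a

    AltBoth⇒AltWalk′ : ∀ b xs → AltBoth b xs → AltWalk M′ (not b) xs
    AltBoth⇒AltWalk′ b     []           _       = tt
    AltBoth⇒AltWalk′ b     (u ∷ [])     _       = tt
    AltBoth⇒AltWalk′ true  (u ∷ v ∷ xs) (m , a) = ∈E⇒Adj (isMatching true) m , AltBoth⇒AltWalk′ false (v ∷ xs) a
    AltBoth⇒AltWalk′ false (u ∷ v ∷ xs) (m , a) = m , AltBoth⇒AltWalk′ true (v ∷ xs) a

    -- Getting stuck after an M′-edge would give an M′-augmenting path from x.
    stuck⇒EvenAltPath : Stuck → EvenAltPath M x
    stuck⇒EvenAltPath (true , h , r , I , h-exposed) = record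
      { start = h ; path = r ; unique = Growing.unique I
      ; alternating = AltBoth⇒AltWalk false (h ∷ r) (Growing.alternating I)
      ; odd-vertex-count = Growing.parity I ; start-exposed = h-exposed ; ends-at = Growing.ends-at I }
    stuck⇒EvenAltPath (false , h , [] , I , _) = contradiction (Growing.parity I) λ ()
    stuck⇒EvenAltPath (false , h , a ∷ r , I , h-exposed) =
      ⊥-elim (exposed-pair⇒¬rematchable maxM′ (h ∷ a ∷ r) (Growing.unique I) (Growing.parity I)
               (AltWalk⇒pairUp-edges (h ∷ a ∷ r) alt) closed (here refl) x∈ h≢x h-exposed x-exposed′)
      where
      alt : AltWalk M′ false (h ∷ a ∷ r)
      alt = AltBoth⇒AltWalk′ true (h ∷ a ∷ r) (Growing.alternating I)
      x∈ : x ∈ h ∷ a ∷ r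
      x∈ = there (subst (_∈ a ∷ r) (Growing.ends-at I) (lastOf-∈ a r))
      h≢x : h ≢ x
      h≢x eq = Unique[x∷xs]⇒x∉xs (Growing.unique I) (subst (_∈ a ∷ r) (trans (Growing.ends-at I) (sym eq)) (lastOf-∈ a r))
      closed : MClosed M′ (h ∷ a ∷ r)
      closed m u∈ = AltWalk-MClosed (isMatching false) false h (a ∷ r) (h ∷ a ∷ r) alt id
                      (λ _ m′ → ⊥-elim (h-exposed (∈E⇒Saturated m′)))
                      (λ m′ → ⊥-elim (x-exposed′ (∈E⇒Saturated (subst (λ v → (v , _) ∈E M′) (Growing.ends-at I) m′)))) u∈ m

    evenAltPath : EvenAltPath M x
    evenAltPath = stuck⇒EvenAltPath (grow-until-stuck n true x [] begin-at-x ≤-refl)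

  odd-cycle : ∀ a P₁ b P₂ → IsWalk (a ∷ P₁ ++ [ b ]) → IsWalk (b ∷ P₂ ++ [ a ]) → Unique (a ∷ P₁ ++ b ∷ P₂) →
              isOdd (length P₁ + length P₂) ≡ true → OddCycle G (a ∷ P₁ ++ b ∷ P₂)
  odd-cycle a P₁ b P₂ walk₁ walk₂ u odd = record
    { distinct = u
    ; long     = subst (3 ≤_) (sym |C|) (s≤s (s≤s (nonzero (length P₁ + length P₂) odd)))
    ; oddLen   = isOdd⇒Odd _ (trans (cong isOdd |C|) (trans (not-involutive _) odd))
    ; adjacent = IsWalk⇒All-AdjE ((a ∷ P₁ ++ b ∷ P₂) ++ [ a ])
        (subst (λ l → IsWalk (a ∷ l)) (sym (++-assoc P₁ (b ∷ P₂) [ a ])) (IsWalk-join (a ∷ P₁) (P₂ ++ [ a ]) walk₁ walk₂))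
    }
    where
    |C| : length (a ∷ P₁ ++ b ∷ P₂) ≡ suc (suc (length P₁ + length P₂))
    |C| = cong suc (trans (length-++ P₁) (+-suc (length P₁) (length P₂)))
    nonzero : ∀ k → isOdd k ≡ true → 1 ≤ k
    nonzero (suc k) _ = s≤s z≤n

  -- S lists the stem from the base c to its exposed end w; S ≡ A ++ x ∷ B places x at distance length A from c.
  module Stem {M : Edges} (maxM : IsMaxMatching G M) {C : List (Fin n)} (F : Flower G M C) where

    c : Fin n
    c = base F

    rest : List (Fin n)
    rest = stem F

    S : List (Fin n)
    S = c ∷ rest

    open IsStem (isStem F) public

    isM : IsMatching G M
    isM = proj₁ maxM

    S-walk : IsWalk S
    S-walk = All-AdjE⇒IsWalk S adjacent

    rest-even : isOdd (length rest) ≡ false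
    rest-even = isOdd-even evenLen

    rest∉C : ∀ {z} → z ∈ rest → z ∉ C
    rest∉C = All.lookup onlyBase

    w : Fin n
    w = lastOf c rest

    w-exposed : ∀ {z} → ¬ (w , z) ∈E M
    w-exposed m = endFree _ (last≡lastOf c rest) (∈E⇒Saturated m)

    -- A stem of even length starting with a non-M edge would end with an M-edge, at a saturated vertex.
    S-AltWalk : AltWalk M true S
    S-AltWalk with rest | adjacent | evenLen | alternating | endFree
    ... | []         | _   | _  | _  | _    = tt
    ... | _ ∷ []     | _   | ev | _  | _    = contradiction (isOdd-even ev) λ ()
    ... | p ∷ q ∷ rs | adj | ev | al | free with (c , p) ∈E? M
    ...   | yes m = Alternating⇒AltWalk-M c p (q ∷ rs) al (All-AdjE⇒IsWalk _ adj) m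
    ...   | no ¬m = ⊥-elim (free _ (last≡lastOf c (p ∷ q ∷ rs))
                      (Alternating-last-Saturated c p q rs al ¬m (isOdd-suc-suc (length rs) (isOdd-even ev))))

    suffix-AltWalk : ∀ A {u} B → S ≡ A ++ u ∷ B → isOdd (length A) ≡ false → AltWalk M true (u ∷ B)
    suffix-AltWalk A B eq even = subst (λ b → AltWalk M b _) (flips-even (length A) true even)
                                   (AltWalk-suffix true A B (subst (AltWalk M true) eq S-AltWalk))

    stem-M-edge : ∀ A {u v} B → S ≡ A ++ u ∷ v ∷ B → isOdd (length A) ≡ false → (u , v) ∈E M
    stem-M-edge A B eq even = proj₁ (suffix-AltWalk A (_ ∷ B) eq even)

    suffix-even : ∀ A {u} B → S ≡ A ++ u ∷ B → isOdd (length A) ≡ false → isOdd (length B) ≡ false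
    suffix-even A B eq even = begin
      isOdd (length B)                           ≡⟨ cong (_xor isOdd (length B)) (sym even) ⟩
      isOdd (length A) xor isOdd (length B)      ≡⟨ sym (isOdd-+ (length A) (length B)) ⟩
      isOdd (length A + length B)                ≡⟨ cong isOdd (sym |rest|) ⟩
      isOdd (length rest)                        ≡⟨ rest-even ⟩
      false                                      ∎
      where
      open ≡-Reasoning
      |rest| : length rest ≡ length A + length B
      |rest| = suc-injective (trans (cong length eq) (trans (length-++ A) (+-suc (length A) (length B))))

    suffix-last : ∀ A {u} B → S ≡ A ++ u ∷ B → lastOf u B ≡ w
    suffix-last []      B refl = refl
    suffix-last (a ∷ A) {u} B eq with ∷-injective eq
    ... | refl , eq′ = trans (sym (lastOf-++ a A u B)) (cong (lastOf a) (sym eq′))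

    suffix-MClosed : ∀ A {x} B → S ≡ A ++ x ∷ B → isOdd (length A) ≡ false → MClosed M (x ∷ B)
    suffix-MClosed A {x} B eq even m u∈ =
      AltWalk-MClosed isM true x B (x ∷ B) (suffix-AltWalk A B eq even) id (λ ())
        (λ m′ → ⊥-elim (w-exposed (subst (λ v → (v , _) ∈E M) (suffix-last A B eq) m′))) u∈ m

    S-MClosed : MClosed M S
    S-MClosed = suffix-MClosed [] rest refl refl

    even-position⇒Dset : ∀ A {x} B → S ≡ A ++ x ∷ B → isOdd (length A) ≡ false → Dset G x
    even-position⇒Dset A {x} B eq even =
      Dset-by-rematching maxM x B (Unique-++⁻ʳ A (subst Unique eq distinct)) (suffix-even A B eq even)
        (IsWalk⇒pairUp-edges B (IsWalk-tail B (IsWalk-++⁻ʳ A (x ∷ B) (subst IsWalk eq S-walk))))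
        (suffix-MClosed A B eq even)

    WalkF-snoc : ∀ {u v x d} → WalkF F u v d → EdgeF F v x → WalkF F u x (suc d)
    WalkF-snoc here         e = step e here
    WalkF-snoc (step e′ ws) e = step e′ (WalkF-snoc ws e)

    stem-walk-back : ∀ (P : List (Fin n)) {y x} → (∀ {u v} → (u , v) ∈ pairs (y ∷ P ++ [ x ]) → (u , v) ∈ pairs S) →
                     WalkF F x y (suc (length P))
    stem-walk-back []      ⊆S = step (inj₂ (inj₂ (⊆S (here refl)))) here
    stem-walk-back (p ∷ P) ⊆S = WalkF-snoc (stem-walk-back P (⊆S ∘ there)) (inj₂ (inj₂ (⊆S (here refl))))

    walk-to-base : ∀ A {x} B → S ≡ A ++ x ∷ B → WalkF F x c (length A)
    walk-to-base []      B eq with ∷-injective eq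
    ... | refl , _ = here
    walk-to-base (a ∷ P) {x} B eq with ∷-injective eq
    ... | refl , eq′ = stem-walk-back P ⊆S
      where
      ⊆S : ∀ {u v} → (u , v) ∈ pairs (c ∷ P ++ [ x ]) → (u , v) ∈ pairs S
      ⊆S {u} {v} m = subst (λ l → (u , v) ∈ pairs l) (sym eq)
                       (subst ((u , v) ∈_) (sym (pairs-++-∷ (c ∷ P) x B)) (∈-++⁺ˡ m))

    -- Stem vertices other than c have no blossom edges, so a walk to c must traverse the stem.
    walk-to-base-length : ∀ {u d} → WalkF F u c d → ∀ A B → S ≡ A ++ u ∷ B → length A ≤ d
    walk-to-base-length here A B eq with Unique⇒position-unique {A₁ = A} {A₂ = []} (subst Unique eq distinct) (sym eq)
    ... | refl , _ = z≤n
    walk-to-base-length (step (inj₁ e) _) []      B eq = z≤n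
    walk-to-base-length {u} (step (inj₁ e) _) (a ∷ A) B eq =
      ⊥-elim (rest∉C (subst (u ∈_) (sym (proj₂ (∷-injective eq))) (∈-++⁺ʳ A (here refl))) (proj₁ (∈E-cycEdges⇒∈ C e)))
    walk-to-base-length (step (inj₂ (inj₁ m)) ws) A B eq with pairs-successor distinct eq m
    ... | B′ , refl = m≤n⇒m≤1+n (m+n≤o⇒m≤o (length A) (≤-trans (≤-reflexive (sym (length-++ A)))
                        (walk-to-base-length ws (A ++ [ _ ]) B′ (trans eq (sym (++-assoc A [ _ ] (_ ∷ B′)))))))
    walk-to-base-length {u} (step (inj₂ (inj₂ m)) ws) A B eq with pairs-predecessor distinct eq m
    ... | A′ , refl = subst (_≤ _) (sym (trans (length-++ A′) (+-comm (length A′) 1)))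
                        (s≤s (walk-to-base-length ws A′ (u ∷ B) (trans eq (++-assoc A′ [ _ ] (u ∷ B)))))

    distance-to-base : ∀ A {x} B d → S ≡ A ++ x ∷ B → DistF F x c d → d ≡ length A
    distance-to-base A B d eq (ws , shortest) =
      ≤-antisym (shortest (length A) (walk-to-base A B eq)) (walk-to-base-length ws A B eq)

    odd-position-mate : ∀ A {p} B → S ≡ A ++ p ∷ B → isOdd (length A) ≡ true →
                        ∃₂ λ A′ q → S ≡ A′ ++ q ∷ p ∷ B × isOdd (length A′) ≡ false × (q , p) ∈E M
    odd-position-mate A {p} B eq odd with initLast A
    ... | A′ ∷ʳ′ q = A′ , q , eq′ , even , stem-M-edge A′ B eq′ even
      where
      eq′ : S ≡ A′ ++ q ∷ p ∷ B
      eq′ = trans eq (++-assoc A′ [ q ] (p ∷ B))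
      even : isOdd (length A′) ≡ false
      even = trans (sym (not-involutive _)) (cong not (trans (sym (isOdd-∷ʳ A′ q)) odd))

    -- Rematch C − x along the cycle read from x, and the stem along itself: only x is left exposed.
    blossom⇒Dset : OddCycle G C → ∀ {x} → x ∈ C → Dset G x
    blossom⇒Dset oc {x} x∈C = go (rotate (OddCycle.distinct oc) x∈C)
      where
      go : Rotation C x → Dset G x
      go record { K = K ; ⊆rotated = ⊆rot ; rotated⊆ = rot⊆ ; unique = uK ; edges⊆ = e⊆ ; length≡ = len } =
        Dset-by-rematching maxM x (K ++ rest) uL evenL adjL closed
        where
        m = cycMEdges M C
        |K| : length K ≡ m + m
        |K| = suc-injective (trans len (trans (sym (blossom F)) (cong (λ j → suc (m + j)) (+-identityʳ m))))
        evenK : isOdd (length K) ≡ false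
        evenK = trans (cong isOdd |K|) (isOdd-double m)
        evenL : isOdd (length (K ++ rest)) ≡ false
        evenL = trans (cong isOdd (length-++ K)) (trans (isOdd-+ (length K) (length rest))
                  (cong₂ _xor_ evenK rest-even))
        uL : Unique (x ∷ K ++ rest)
        uL = ++⁺ uK (AllPairs.tail distinct) (λ (m₁ , m₂) → rest∉C m₂ (rot⊆ m₁))
        K-walk : IsWalk K
        K-walk = IsWalk-tail K (IsWalk-++⁻ˡ (x ∷ K) [ x ]
                   (All-AdjE⇒IsWalk ((x ∷ K) ++ [ x ]) (All.tabulate (All.lookup (OddCycle.adjacent oc) ∘ e⊆))))
        adjL : All AdjE (pairUp (K ++ rest))
        adjL = subst (All AdjE) (sym (pairUp-++ K rest evenK))
                 (AllP.++⁺ (IsWalk⇒pairUp-edges K K-walk) (IsWalk⇒pairUp-edges rest (IsWalk-tail rest S-walk)))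
        S⊆L : ∀ {z} → z ∈ S → z ∈ x ∷ K ++ rest
        S⊆L (here refl) = ∈-++⁺ˡ {ys = rest} (⊆rot (proj₁ (isBase F)))
        S⊆L (there z∈)  = ∈-++⁺ʳ (x ∷ K) z∈
        closed : MClosed M (x ∷ K ++ rest)
        closed {u} m u∈L with ∈-++⁻ (x ∷ K) u∈L
        ... | inj₂ u∈rest = S⊆L (S-MClosed m (there u∈rest))
        ... | inj₁ u∈C with u ≟ c
        ...   | yes refl = S⊆L (S-MClosed m (here refl))
        ...   | no u≢c with blossom-mate isM (OddCycle.distinct oc) (blossom F) (isBase F) (OddCycle.long oc) (rot⊆ u∈C) u≢c
        ...     | z , z∈C , uz rewrite mate-unique isM m uz = ∈-++⁺ˡ (⊆rot z∈C)

  module RDisjointStem (rd : RDisjoint G) {M : Edges} (maxM : IsMaxMatching G M) {C : List (Fin n)}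
                       (oc : OddCycle G C) (F : Flower G M C) where
    open Stem maxM F public

    -- z lies in R(C) through F, and in R(C′) through any flower of C′, which R-disjointness provides.
    rest∉odd-cycle : ∀ {C′} → OddCycle G C′ → ∀ {z} → z ∈ C′ → z ∈ rest → ⊥
    rest∉odd-cycle {h ∷ t} oc′ {z} z∈C′ z∈rest = proj₂ (proj₂ rd) C (h ∷ t) oc oc′ different z reach reach′
      where
      edge = ∈⇒∈-pairs-∷ʳ (h ∷ t) h z∈C′
      different : ¬ SameCycle C (h ∷ t)
      different same = rest∉C z∈rest (proj₁ (∈E-cycEdges⇒∈ C (proj₂ (same (z , proj₁ edge)) (inj₁ (proj₂ edge)))))
      reach : Reach G C z
      reach = M , maxM , F , inj₂ (there z∈rest)
      reach′ : Reach G (h ∷ t) z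
      reach′ with proj₁ (proj₂ rd) (h ∷ t) oc′
      ... | _ , M′ , maxM′ , F′ , _ = M′ , maxM′ , F′ , inj₁ z∈C′

    ∈-rest-after : ∀ A {p} Mid {u} B → S ≡ A ++ p ∷ Mid ++ u ∷ B → u ∈ rest
    ∈-rest-after []      Mid B eq = subst (_ ∈_) (sym (proj₂ (∷-injective eq))) (∈-++⁺ʳ Mid (here refl))
    ∈-rest-after (a ∷ A) {p} Mid {u} B eq =
      subst (_ ∈_) (sym (proj₂ (∷-injective eq)))
        (subst (u ∈_) (++-assoc A (p ∷ Mid) (u ∷ B)) (∈-++⁺ʳ (A ++ p ∷ Mid) (here refl)))

    stem-segment : ∀ A {p} Mid {p′} B → S ≡ A ++ p ∷ Mid ++ p′ ∷ B →
                   IsWalk (p ∷ Mid ++ [ p′ ]) × Unique (p ∷ Mid ++ [ p′ ]) × (∀ {z} → z ∈ p ∷ Mid ++ [ p′ ] → z ∈ S)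
    stem-segment A {p} Mid {p′} B eq =
      IsWalk-++⁻ˡ (p ∷ Mid ++ [ p′ ]) B (subst IsWalk eq′ (IsWalk-++⁻ʳ A _ (subst IsWalk eq S-walk))) ,
      Unique-++⁻ˡ (p ∷ Mid ++ [ p′ ]) (subst Unique eq′ (Unique-++⁻ʳ A (subst Unique eq distinct))) ,
      λ {z} m → subst (z ∈_) (sym eq) (∈-++⁺ʳ A (subst (z ∈_) (sym eq′) (∈-++⁺ˡ m)))
      where
      eq′ : p ∷ Mid ++ p′ ∷ B ≡ (p ∷ Mid ++ [ p′ ]) ++ B
      eq′ = cong (p ∷_) (sym (++-assoc Mid [ p′ ] B))

    -- Otherwise the detour and the stem segment between p and p′ form an odd cycle through p′ ∈ rest.
    forward-detour-parity : ∀ A {p} Mid {p′} B R → S ≡ A ++ p ∷ Mid ++ p′ ∷ B → IsWalk (p ∷ R ++ [ p′ ]) →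
                            Unique (p ∷ R ++ [ p′ ]) → All (_∉ S) R → isOdd (length R) ≡ isOdd (length Mid)
    forward-detour-parity A {p} Mid {p′} B R eq walkR uR R∉S with isOdd (length R) ≟ᵇ isOdd (length Mid)
    ... | yes same = same
    ... | no differ = ⊥-elim (rest∉odd-cycle cycle (∈-++⁺ʳ (p ∷ R) (here refl)) (∈-rest-after A Mid B eq))
      where
      segment = stem-segment A Mid B eq
      back : Unique (p′ ∷ reverse Mid ++ [ p ])
      back = Unique-reverse-ends (proj₁ (proj₂ segment))
      ucycle : Unique (p ∷ R ++ p′ ∷ reverse Mid)
      ucycle = ++⁺ (Unique-++⁻ˡ (p ∷ R) uR) (Unique-++⁻ˡ (p′ ∷ reverse Mid) back) λ where
        (here refl , m) → Unique-++⇒Disjoint (p′ ∷ reverse Mid) back (m , here refl)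
        (there z∈R , here refl) → All.lookup R∉S z∈R (proj₂ (proj₂ segment) (∈-++⁺ʳ (p ∷ Mid) (here refl)))
        (there z∈R , there m) → All.lookup R∉S z∈R (proj₂ (proj₂ segment) (there (∈-++⁺ˡ {xs = Mid} (reverse⁻ m))))
      odd : isOdd (length R + length (reverse Mid)) ≡ true
      odd = trans (cong (λ k → isOdd (length R + k)) (length-reverse Mid))
              (trans (isOdd-+ (length R) (length Mid))
                (trans (cong (_xor isOdd (length Mid)) (¬-not differ)) (xor-inverseˡ (isOdd (length Mid)))))
      cycle = odd-cycle p R p′ (reverse Mid) walkR (IsWalk-reverse-ends Mid (proj₁ segment)) ucycle odd

    stem-detour-parity : ∀ A {p} B A′ {p′} B′ R → S ≡ A ++ p ∷ B → S ≡ A′ ++ p′ ∷ B′ → p ≢ p′ →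
      IsWalk (p ∷ R ++ [ p′ ]) → Unique (p ∷ R ++ [ p′ ]) → All (_∉ S) R →
      isOdd (suc (length R)) ≡ isOdd (length A) xor isOdd (length A′)
    stem-detour-parity A {p} B A′ {p′} B′ R eq eq′ p≢p′ walkR uR R∉S with positions-ordered A A′ B B′ p≢p′ (trans (sym eq) eq′)
    ... | inj₁ (Mid , refl , refl) = begin
      not (isOdd (length R))             ≡⟨ cong not (forward-detour-parity A Mid B′ R eq walkR uR R∉S) ⟩
      not m                              ≡⟨ sym (xor-cancelˡ a (not m)) ⟩
      a xor (a xor not m)                ≡⟨ cong (a xor_) (sym (isOdd-++-∷ A Mid)) ⟩
      a xor isOdd (length (A ++ p ∷ Mid)) ∎
      where
      open ≡-Reasoning
      a = isOdd (length A)
      m = isOdd (length Mid)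
    ... | inj₂ (Mid , refl , refl) = begin
      not (isOdd (length R))              ≡⟨ cong (not ∘ isOdd) (sym (length-reverse R)) ⟩
      not (isOdd (length (reverse R)))    ≡⟨ cong not (forward-detour-parity A′ Mid B (reverse R) eq′
                                               (IsWalk-reverse-ends R walkR) (Unique-reverse-ends uR)
                                               (All.tabulate (All.lookup R∉S ∘ reverse⁻))) ⟩
      not m                               ≡⟨ sym (xor-cancelˡ a′ (not m)) ⟩
      a′ xor (a′ xor not m)               ≡⟨ xor-comm a′ _ ⟩
      (a′ xor not m) xor a′               ≡⟨ cong (_xor a′) (sym (isOdd-++-∷ A′ Mid)) ⟩
      isOdd (length (A′ ++ p′ ∷ Mid)) xor a′ ∎
      where
      open ≡-Reasoning
      a′ = isOdd (length A′)
      m  = isOdd (length Mid)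

    module OddPosition {Ax x Bx} (x-at : S ≡ Ax ++ x ∷ Bx) (x-odd : isOdd (length Ax) ≡ true) where

      x∈S : x ∈ S
      x∈S = subst (x ∈_) (sym x-at) (∈-++⁺ʳ Ax (here refl))

      reached-x⇒⊥ : ∀ p s A B → S ≡ A ++ p ∷ B → isOdd (length (p ∷ s)) ≡ not (isOdd (length A)) →
                    lastOf p s ≡ x → All (_∉ S) s → ⊥
      reached-x⇒⊥ p [] A B eq odd refl _
        with Unique⇒position-unique {A₁ = A} {A₂ = Ax} (subst Unique eq distinct) (trans (sym eq) x-at)
      ... | refl , _ = contradiction (trans odd (cong not x-odd)) λ ()
      reached-x⇒⊥ p (s₁ ∷ s) A B _ _ ends s∉S = All.lookup s∉S (subst (_∈ s₁ ∷ s) ends (lastOf-∈ s₁ s)) x∈S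

      -- The remaining path p ∷ s to x leaves the stem vertex p = S[|A|] towards c: along M iff |A| is odd.
      path-along-stem⇒⊥ : ∀ fuel p s A B → length s < fuel → S ≡ A ++ p ∷ B → Unique (p ∷ s) →
        AltWalk M (isOdd (length A)) (p ∷ s) → isOdd (length (p ∷ s)) ≡ not (isOdd (length A)) → lastOf p s ≡ x → ⊥
      path-along-stem⇒⊥ (suc fuel) p s A B |s|< eq u alt odd ends with splitAtFirst (_∈? S) s
      ... | inj₁ s∉S = reached-x⇒⊥ p s A B eq odd ends s∉S
      ... | inj₂ (R , s′ , p′ , refl , p′∈S , R∉S) with ∈-∃++ p′∈S
      ...   | A′ , B′ , eq′ =
        path-along-stem⇒⊥ fuel p′ s′ A′ B′ |s′|< eq′ (Unique-++⁻ʳ (p ∷ R) u) alt′ odd′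
          (trans (sym (lastOf-++ p R p′ s′)) ends)
        where
        a  = isOdd (length A)
        a′ = isOdd (length A′)
        p≢p′ : p ≢ p′
        p≢p′ refl = Unique[x∷xs]⇒x∉xs u (∈-++⁺ʳ R (here refl))
        eq-seg : p ∷ R ++ p′ ∷ s′ ≡ (p ∷ R ++ [ p′ ]) ++ s′
        eq-seg = cong (p ∷_) (sym (++-assoc R [ p′ ] s′))
        detour : isOdd (suc (length R)) ≡ a xor a′
        detour = stem-detour-parity A B A′ B′ R eq eq′ p≢p′
                   (IsWalk-++⁻ˡ (p ∷ R ++ [ p′ ]) s′ (subst IsWalk eq-seg (AltWalk⇒IsWalk isM a (p ∷ R ++ p′ ∷ s′) alt)))
                   (Unique-++⁻ˡ (p ∷ R ++ [ p′ ]) (subst Unique eq-seg u)) R∉S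
        alt′ : AltWalk M a′ (p′ ∷ s′)
        alt′ = subst (λ b → AltWalk M b (p′ ∷ s′))
                 (trans (flips-isOdd (suc (length R)) a) (trans (cong (a xor_) detour) (xor-cancelˡ a a′)))
                 (AltWalk-suffix a (p ∷ R) s′ alt)
        odd′ : isOdd (length (p′ ∷ s′)) ≡ not a′
        odd′ = solve a a′ (isOdd (length (p′ ∷ s′)))
                 (trans (cong (_xor not (isOdd (length s′))) (sym detour)) (trans (sym (isOdd-++-∷ (p ∷ R) s′)) odd))
          where
          solve : ∀ a a′ l → (a xor a′) xor l ≡ not a → l ≡ not a′
          solve true  true  true  ()
          solve true  true  false _ = refl
          solve true  false true  _ = refl
          solve true  false false ()
          solve false true  true  ()
          solve false true  false _ = refl
          solve false false true  _ = refl
          solve false false false ()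
        |s′|< : length s′ < fuel
        |s′|< = ≤-trans (m≤n+m (suc (length s′)) (length R)) (≤-trans (≤-reflexive (sym (length-++ R))) (≤-pred |s|<))

      module _ (Q : EvenAltPath M x) where
        open EvenAltPath Q renaming (unique to Q-unique; alternating to Q-alternating)

        consistent⇒⊥ : ∀ R₀ {p} s A B → start ∷ path ≡ R₀ ++ p ∷ s → S ≡ A ++ p ∷ B →
                       isOdd (length R₀) ≡ isOdd (length A) → ⊥
        consistent⇒⊥ R₀ {p} s A B eqQ eq same =
          path-along-stem⇒⊥ (suc (length s)) p s A B ≤-refl eq (Unique-++⁻ʳ R₀ (subst Unique eqQ Q-unique))
            (subst (λ b → AltWalk M b (p ∷ s)) (trans (flips-isOdd (length R₀) false) same)
              (AltWalk-suffix false R₀ s (subst (AltWalk M false) eqQ Q-alternating)))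
            (trans (xor≡true⇒ (trans (sym (isOdd-++-∷ R₀ s)) (trans (cong (isOdd ∘ length) (sym eqQ)) odd-vertex-count)))
                   (cong not same))
            (trans (sym (lastOf-eq eqQ)) ends-at)
          where
          xor≡true⇒ : ∀ {a b} → a xor b ≡ true → b ≡ not a
          xor≡true⇒ {true}  {false} _ = refl
          xor≡true⇒ {false} {true}  _ = refl
          lastOf-eq : ∀ {R₀ s} → start ∷ path ≡ R₀ ++ p ∷ s → lastOf start path ≡ lastOf p s
          lastOf-eq {[]}     eq′ with ∷-injective eq′
          ... | refl , refl = refl
          lastOf-eq {r ∷ R₀} {s} eq′ with ∷-injective eq′
          ... | refl , refl = lastOf-++ r R₀ p s

        -- Q followed by the stem from p to w would be an M-augmenting path.
        augmenting⇒⊥ : ∀ R₀ {p} s A B → start ∷ path ≡ R₀ ++ p ∷ s → All (_∉ S) R₀ → S ≡ A ++ p ∷ B →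
                       isOdd (length A) ≡ false → isOdd (length R₀) ≡ true → ⊥
        augmenting⇒⊥ []       s A B eqQ R₀∉S eq even ()
        augmenting⇒⊥ (r ∷ R₀) {p} s A B eqQ R₀∉S eq even odd =
          exposed-pair⇒¬rematchable maxM L uL evenL (AltWalk⇒pairUp-edges L altL) closed
            (here refl) (subst (_∈ L) lastL (lastOf-∈ r (R₀ ++ p ∷ B))) r≢w
            (subst (λ v → ¬ Saturated M v) r≡start start-exposed) (w-exposed ∘ proj₂ ∘ Saturated⇒mate)
          where
          L = (r ∷ R₀) ++ p ∷ B
          r≡start : start ≡ r
          r≡start = proj₁ (∷-injective eqQ)
          alt : AltWalk M false ((r ∷ R₀) ++ p ∷ s)
          alt = subst (AltWalk M false) eqQ Q-alternating
          altL : AltWalk M false L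
          altL = AltWalk-join false (r ∷ R₀) B (proj₁ (AltWalk-split false (r ∷ R₀) s alt))
                   (subst (λ b → AltWalk M b (p ∷ B)) (sym (trans (flips-isOdd (length (r ∷ R₀)) false) odd))
                     (suffix-AltWalk A B eq even))
          pB⊆S : ∀ {z} → z ∈ p ∷ B → z ∈ S
          pB⊆S m = subst (_ ∈_) (sym eq) (∈-++⁺ʳ A m)
          uL : Unique L
          uL = ++⁺ (Unique-++⁻ˡ (r ∷ R₀) (subst Unique eqQ Q-unique)) (Unique-++⁻ʳ A (subst Unique eq distinct))
                   (λ (m₁ , m₂) → All.lookup R₀∉S m₁ (pB⊆S m₂))
          evenL : isOdd (length L) ≡ false
          evenL = trans (isOdd-++-∷ (r ∷ R₀) B) (cong₂ (λ a b → a xor not b) odd (suffix-even A B eq even))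
          lastL : lastOf r (R₀ ++ p ∷ B) ≡ w
          lastL = trans (lastOf-++ r R₀ p B) (suffix-last A B eq)
          r≢w : r ≢ w
          r≢w r≡w = All.lookup R₀∉S (here refl) (subst (_∈ S) (sym r≡w) (lastOf-∈ c rest))
          closed : MClosed M L
          closed m u∈ = AltWalk-MClosed isM false r (R₀ ++ p ∷ B) L altL id
                          (λ _ m′ → ⊥-elim (start-exposed (subst (λ v → Saturated M v) (sym r≡start) (∈E⇒Saturated m′))))
                          (λ m′ → ⊥-elim (w-exposed (subst (λ v → (v , _) ∈E M) lastL m′))) u∈ m

        -- Q would enter p by an M-edge from outside S, but p is matched to its predecessor on the stem.
        mate-clash⇒⊥ : ∀ R₀ {p} s A B → start ∷ path ≡ R₀ ++ p ∷ s → All (_∉ S) R₀ → S ≡ A ++ p ∷ B →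
                       isOdd (length A) ≡ true → isOdd (length R₀) ≡ false → ⊥
        mate-clash⇒⊥ R₀ {p} s A B eqQ R₀∉S eq odd even with odd-position-mate A B eq odd
        ... | A′ , q , eq′ , _ , qp with initLast R₀
        ...   | [] = start-exposed (subst (Saturated M) (sym (proj₁ (∷-injective eqQ))) (∈E⇒Saturated (∈E-sym qp)))
        ...   | ini ∷ʳ′ v = All.lookup R₀∉S (∈-++⁺ʳ ini (here refl)) (subst (_∈ S) (sym v≡q) q∈S)
          where
          q∈S : q ∈ S
          q∈S = subst (q ∈_) (sym eq′) (∈-++⁺ʳ A′ (here refl))
          odd-ini : isOdd (length ini) ≡ true
          odd-ini = trans (sym (not-involutive _)) (cong not (trans (sym (isOdd-∷ʳ ini v)) even))
          vp : (v , p) ∈E M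
          vp = subst (λ b → Step M b v p) (flips-odd (length ini) false odd-ini)
                 (AltWalk-step false ini s (subst (AltWalk M false) (trans eqQ (++-assoc ini [ v ] (p ∷ s))) Q-alternating))
          v≡q : v ≡ q
          v≡q = mate-unique isM (∈E-sym vp) (∈E-sym qp)

        EvenAltPath⇒⊥ : ⊥
        EvenAltPath⇒⊥ with splitAtFirst (_∈? S) (start ∷ path)
        ... | inj₁ Q∉S = All.lookup Q∉S (subst (_∈ start ∷ path) ends-at (lastOf-∈ start path)) x∈S
        ... | inj₂ (R₀ , s , p , eqQ , p∈S , R₀∉S) with ∈-∃++ p∈S
        ...   | A , B , eq with isOdd (length R₀) ≟ᵇ isOdd (length A)
        ...     | yes same = consistent⇒⊥ R₀ s A B eqQ eq same
        ...     | no differ with isOdd (length A) in eqA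
        ...       | false = augmenting⇒⊥ R₀ s A B eqQ R₀∉S eq eqA (¬-not differ)
        ...       | true  = mate-clash⇒⊥ R₀ s A B eqQ R₀∉S eq eqA (¬-not differ)

      x∉Dset : ¬ Dset G x
      x∉Dset (M′ , maxM′ , x-exposed′) = EvenAltPath⇒⊥ (SymmetricDifference.evenAltPath maxM maxM′ x-exposed′)

mainTheorem9 : ∀ {n} (G : Graph n) → RDisjoint G →
    ∀ (C : List (Fin n)) → OddCycle G C → ∀ (x : Fin n) → Reach G C x →
    ∀ M → IsMaxMatching G M → (F : Flower G M C) → x ∈VF F →
    (x ∈ C → Dset G x) ×
    (x ∉ C → ∀ d → DistF F x (base F) d → Even d → Dset G x) ×
    (x ∉ C → ∀ d → DistF F x (base F) d → Odd d → Aset G x)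
mainTheorem9 G rd C oc x _ M maxM F x∈F = blossom⇒Dset oc , even-distance , odd-distance
  where
  open RDisjointStem G rd maxM oc F
  x∈S : x ∉ C → x ∈ S
  x∈S x∉C = [ ⊥-elim ∘ x∉C , id ]′ x∈F
  position-parity : ∀ A B d → S ≡ A ++ x ∷ B → DistF F x c d → isOdd (length A) ≡ isOdd d
  position-parity A B d eq dist = cong isOdd (sym (distance-to-base A B d eq dist))
  even-distance : x ∉ C → ∀ d → DistF F x c d → Even d → Dset G x
  even-distance x∉C d dist even with ∈-∃++ (x∈S x∉C)
  ... | A , B , eq = even-position⇒Dset A B eq (trans (position-parity A B d eq dist) (isOdd-even even))
  odd-distance : x ∉ C → ∀ d → DistF F x c d → Odd d → Aset G x
  odd-distance x∉C d dist odd with ∈-∃++ (x∈S x∉C)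
  ... | A , B , eq with trans (position-parity A B d eq dist) (isOdd-odd odd)
  ...   | oddA with odd-position-mate A B eq oddA
  ...     | A′ , q , eq′ , evenA′ , qx =
    OddPosition.x∉Dset eq oddA , q , Adj-sym G (∈E⇒Adj G isM qx) , even-position⇒Dset A′ (x ∷ B) eq′ evenA′
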